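{- Let $K$ be a field and let $\mathcal C$ be the free $K$-vector space on isomorphism classes of convex geometries, with coproduct $\Delta(Z,E)=\sum_{X\in E}M(\emptyset,X)\otimes M(X,Z)$ and counit $\epsilon(Z,E)=1$ if $Z=\emptyset$, $0$ otherwise. The multiplication $m:\mathcal C\otimes\mathcal C\to\mathcal C$, $m((Z_1,E_1)\otimes(Z_2,E_2))=(Z_1\cup Z_2,E_{Z_1Z_2})$ (the product convex geometry, computed on representatives with $Z_1\cap Z_2=\emptyset$), is well defined and turns $\mathcal C$ into a bialgebra.
   Context: A convex geometry is a pair $(Z,E)$ with $Z$ a finite set and $E\subseteq 2^Z$ satisfying: (i) $\emptyset\in E$, $Z\in E$; (ii) $X,Y\in E\Rightarrow X\cap Y\in E$; (iii) for every $X\in E\setminus\{Z\}$ there is $z\in Z\setminus X$ with $X\cup\{z\}\in E$. The lattice $L(Z,E)$ is $E$ ordered by inclusion; two convex geometries are isomorphic if their lattices are isomorphic. For closed $A\subseteq B$, the minor $M(A,B)$ is the convex geometry with closed sets $\{X\setminus A: X\in E, A\subseteq X\subseteq B\}$. For disjoint $Z_1,Z_2$, $E_{Z_1Z_2}=\{X_1\cup X_2: X_1\in E_1, X_2\in E_2\}$. -}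

module Defs where

open import Level using (Level; _⊔_; suc)
open import Data.Nat using (ℕ; zero) renaming (suc to sucℕ; _+_ to _+ℕ_)
open import Data.Bool using (Bool; true; false; _∧_; _∨_)
open import Data.Fin using (Fin)
open import Data.Fin.Subset using (Subset; ⊥; ⁅_⁆; _∈_; _∉_; _⊆_; _∩_; _∪_; _─_)
open import Data.Fin.Subset.Properties using (_⊆?_)
open import Data.Vec using (Vec; []; _∷_; _++_; take; drop)
open import Data.Vec.Properties using (≡-dec)
open import Data.List using (List; []; _∷_; map; concatMap; foldr; filterᵇ)
open import Data.Bool.ListAction using (any)
open import Data.Product using (_×_; _,_; ∃; Σ)
open import Relation.Nullary using (¬_)
open import Relation.Nullary.Decidable using (⌊_⌋)
open import Relation.Binary.PropositionalEquality using (_≡_)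
open import Function.Bundles using (_⇔_)
open import Algebra.Bundles using (CommutativeRing)
import Data.Bool.Properties as BoolP

record Field (c ℓ : Level) : Set (suc (c ⊔ ℓ)) where
  field
    commutativeRing : CommutativeRing c ℓ
  open CommutativeRing commutativeRing public
  field
    1≉0     : ¬ (1# ≈ 0#)
    inverse : ∀ x → ¬ (x ≈ 0#) → ∃ λ y → x * y ≈ 1#

-- A set system on a finite ground set Z is encoded by
-- an ambient size n, the ground set Z ⊆ Fin n and the (decidable)
-- family E of subsets, given by its characteristic function.
-- Every finite set Z is in bijection with some Fin n, and convex
-- geometries are only considered up to isomorphism of lattices,
-- so this encoding loses nothing.

record SetSystem : Set where
  constructor setSystem
  field
    n  : ℕ
    Z  : Subset n
    E  : Subset n → Bool

open SetSystem public

Closed : (G : SetSystem) → Subset (n G) → Set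
Closed G X = E G X ≡ true

record IsConvexGeometry (G : SetSystem) : Set where
  field
    closed⊆Z  : ∀ X → Closed G X → X ⊆ Z G
    ∅-closed  : Closed G ⊥
    Z-closed  : Closed G (Z G)
    ∩-closed  : ∀ X Y → Closed G X → Closed G Y → Closed G (X ∩ Y)
    extension : ∀ X → Closed G X → ¬ (X ≡ Z G) →
                ∃ λ z → (z ∈ Z G) × (z ∉ X) × Closed G (X ∪ ⁅ z ⁆)

-- isomorphism: an isomorphism of the lattices L(Z,E) = (E, ⊆)
record Iso (G H : SetSystem) : Set where
  field
    to     : Subset (n G) → Subset (n H)
    from   : Subset (n H) → Subset (n G)
    to-cl   : ∀ X → Closed G X → Closed H (to X)
    from-cl : ∀ Y → Closed H Y → Closed G (from Y)
    from-to : ∀ X → Closed G X → from (to X) ≡ X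
    to-from : ∀ Y → Closed H Y → to (from Y) ≡ Y
    order  : ∀ X X' → Closed G X → Closed G X' → (X ⊆ X' ⇔ to X ⊆ to X')

allSubsets : (n : ℕ) → List (Subset n)
allSubsets zero     = [] ∷ []
allSubsets (sucℕ n) =
  map (false ∷_) (allSubsets n) Data.List.++ map (true ∷_) (allSubsets n)

_≟ˢ_ : ∀ {n} (X Y : Subset n) → _
_≟ˢ_ = ≡-dec BoolP._≟_

-- the minor M(A,B): ground set B ∖ A, closed sets
-- { X ∖ A : X ∈ E, A ⊆ X ⊆ B }
minor : (G : SetSystem) → Subset (n G) → Subset (n G) → SetSystem
minor G A B = setSystem (n G) (B ─ A)
  (λ Y → any (λ X → E G X ∧ ⌊ A ⊆? X ⌋ ∧ ⌊ X ⊆? B ⌋ ∧ ⌊ (X ─ A) ≟ˢ Y ⌋)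
             (allSubsets (n G)))

-- the product (Z₁ ⊔ Z₂, E_{Z₁Z₂}) on the disjoint union Fin n₁ ⊎ Fin n₂
-- (encoded as Fin (n₁ + n₂)); a subset X = X₁ ∪ X₂ is closed iff
-- X₁ ∈ E₁ and X₂ ∈ E₂.
product : SetSystem → SetSystem → SetSystem
product G H = setSystem (n G +ℕ n H) (Z G ++ Z H)
  (λ X → E G (take (n G) X) ∧ E H (drop (n G) X))

emptyGeometry : SetSystem
emptyGeometry = setSystem 0 [] (λ _ → true)

closedSets : (G : SetSystem) → List (Subset (n G))
closedSets G = filterᵇ (E G) (allSubsets (n G))

isEmptyGround : SetSystem → Bool
isEmptyGround G = ⌊ Z G ≟ˢ ⊥ ⌋

module Spaces {c ℓ} (K : Field c ℓ) where
  open Field K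

  -- formal K-linear combinations of convex geometries
  𝒞 : Set c
  𝒞 = List (Carrier × SetSystem)

  𝒞² : Set c
  𝒞² = List (Carrier × SetSystem × SetSystem)

  𝒞³ : Set c
  𝒞³ = List (Carrier × SetSystem × SetSystem × SetSystem)

  AllCG : 𝒞 → Set c
  AllCG a = Data.List.Relation.Unary.All.All
              (λ p → IsConvexGeometry (Data.Product.proj₂ p)) a
    where import Data.List.Relation.Unary.All

  -- linear functionals on the free space on isomorphism classes
  -- = isomorphism-invariant functions on geometries
  Invariant₁ : (SetSystem → Carrier) → Set (ℓ)
  Invariant₁ f = ∀ G G' → Iso G G' → f G ≈ f G'

  Invariant₂ : (SetSystem → SetSystem → Carrier) → Set ℓ
  Invariant₂ f = ∀ G G' H H' → Iso G G' → Iso H H' → f G H ≈ f G' H'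

  Invariant₃ : (SetSystem → SetSystem → SetSystem → Carrier) → Set ℓ
  Invariant₃ f = ∀ G G' H H' I I' → Iso G G' → Iso H H' → Iso I I' →
                 f G H I ≈ f G' H' I'

  ev₁ : (SetSystem → Carrier) → 𝒞 → Carrier
  ev₁ f = foldr (λ { (k , G) s → k * f G + s }) 0#

  ev₂ : (SetSystem → SetSystem → Carrier) → 𝒞² → Carrier
  ev₂ f = foldr (λ { (k , G , H) s → k * f G H + s }) 0#

  ev₃ : (SetSystem → SetSystem → SetSystem → Carrier) → 𝒞³ → Carrier
  ev₃ f = foldr (λ { (k , G , H , I) s → k * f G H I + s }) 0#

  -- equality in the free vector space on isomorphism classes: two formal
  -- combinations are equal iff every linear functional agrees on them
  -- (i.e. the coefficients of every isomorphism class agree).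
  _≈₁_ : 𝒞 → 𝒞 → Set (c ⊔ ℓ)
  a ≈₁ b = ∀ f → Invariant₁ f → ev₁ f a ≈ ev₁ f b

  _≈₂_ : 𝒞² → 𝒞² → Set (c ⊔ ℓ)
  a ≈₂ b = ∀ f → Invariant₂ f → ev₂ f a ≈ ev₂ f b

  _≈₃_ : 𝒞³ → 𝒞³ → Set (c ⊔ ℓ)
  a ≈₃ b = ∀ f → Invariant₃ f → ev₃ f a ≈ ev₃ f b

  one : 𝒞
  one = (1# , emptyGeometry) ∷ []

  one² : 𝒞²
  one² = (1# , emptyGeometry , emptyGeometry) ∷ []

  _·_ : 𝒞 → 𝒞 → 𝒞
  a · b = concatMap (λ { (k , G) →
            map (λ { (l , H) → (k * l , product G H) }) b }) a

  _·²_ : 𝒞² → 𝒞² → 𝒞²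
  a ·² b = concatMap (λ { (k , G , G') →
             map (λ { (l , H , H') → (k * l , product G H , product G' H') }) b }) a

  Δbasis : SetSystem → 𝒞²
  Δbasis G = map (λ X → (1# , minor G ⊥ X , minor G X (Z G))) (closedSets G)

  scale² : Carrier → 𝒞² → 𝒞²
  scale² k = map (λ { (l , p) → (k * l , p) })

  Δ : 𝒞 → 𝒞²
  Δ = concatMap (λ { (k , G) → scale² k (Δbasis G) })

  εbasis : SetSystem → Carrier
  εbasis G with isEmptyGround G
  ... | true  = 1#
  ... | false = 0#

  ε : 𝒞 → Carrier
  ε = ev₁ εbasis

  Δ⊗id : 𝒞² → 𝒞³
  Δ⊗id = concatMap (λ { (k , G , H) →
           map (λ { (l , G₁ , G₂) → (k * l , G₁ , G₂ , H) }) (Δbasis G) })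

  id⊗Δ : 𝒞² → 𝒞³
  id⊗Δ = concatMap (λ { (k , G , H) →
           map (λ { (l , H₁ , H₂) → (k * l , G , H₁ , H₂) }) (Δbasis H) })

  -- ε ⊗ id and id ⊗ ε : 𝒞 ⊗ 𝒞 → 𝒞 (identifying K ⊗ 𝒞 ≅ 𝒞 ≅ 𝒞 ⊗ K)
  ε⊗id : 𝒞² → 𝒞
  ε⊗id = map (λ { (k , G , H) → (k * εbasis G , H) })

  id⊗ε : 𝒞² → 𝒞
  id⊗ε = map (λ { (k , G , H) → (k * εbasis H , G) })

-- Equality in 𝒞, 𝒞 ⊗ 𝒞 and 𝒞 ⊗ 𝒞 ⊗ 𝒞 is tested against isomorphism-invariant linear forms, so
-- every axiom becomes an identity between finite sums of an invariant function evaluated at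
-- products and minors, and it suffices to compare the summands up to lattice isomorphism.
-- The closed sets of a product are exactly the pairs of closed sets, which makes the product
-- associative and unital and gives M(A₁ ⊔ A₂, B₁ ⊔ B₂) ≅ M(A₁, B₁) × M(A₂, B₂), hence
-- Δ(xy) = Δ(x)Δ(y). The closed sets of M(A, B) are the W ─ A with W closed and A ⊆ W ⊆ B,
-- so a minor of a minor is again a minor; consequently both sides of coassociativity sum
-- g(M(∅, Y), M(Y, X), M(X, Z)) over the pairs Y ⊆ X of closed sets. The counit selects the
-- summand X = ∅ resp. X = Z, because a convex geometry has Z = ∅ exactly when it has only one
-- closed set. Minors inherit axiom (iii) since, inside a convex geometry, any closed W ⊊ B
-- with B closed extends by one element within B.

module Submission where

open import Defs
open import Level using (Level)
open import Data.Nat using (ℕ; zero; suc; _≤_; _<_) renaming (_+_ to _+ℕ_)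
import Data.Nat.Properties as ℕ
open import Data.Bool using (Bool; true; false; _∧_; _∨_; if_then_else_)
open import Data.Bool.Properties using (∧-conicalˡ; ∧-conicalʳ; ∨-identityʳ; T-≡; ¬-not) renaming (_≟_ to _≟ᵇ_)
open import Data.Bool.ListAction using (any)
open import Data.Fin using (Fin; zero; suc; _↑ˡ_; _↑ʳ_)
open import Data.Fin.Subset using (Subset; ⊥; ⊤; ⁅_⁆; _∈_; _∉_; _⊆_; _∩_; _∪_; _─_; ∣_∣; inside; outside)
open import Data.Fin.Subset.Properties
  using (_∈?_; _⊆?_; drop-∷-⊆; ⊆-refl; ⊆-trans; ⊆-antisym; ⊆-min; ⊆-max; p⊆p∪q; q⊆p∪q; x∈p∪q⁻; p∩q⊆p; p∩q⊆q;
         x∈p∩q⁺; p─⊥≡p; p─q⊆p; x∈p∧x∉q⇒x∈p─q; x∈⁅x⁆; x∈⁅y⁆⇒x≡y; ∪-identityʳ; ∩-distribʳ-∪; Empty-unique;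
         ∣p∣≤n; p⊂q⇒∣p∣<∣q∣; anySubset?)
open import Data.Vec using ([]; _∷_; _++_; take; drop)
open import Data.Vec.Base using (here; there)
open import Data.Vec.Properties using (∷-injectiveˡ; ∷-injectiveʳ; ++-injectiveˡ; ++-injectiveʳ; take++drop≡id)
open import Data.List using (List; []; _∷_; map; concatMap; foldr; filterᵇ) renaming (_++_ to _++ₗ_)
open import Data.List.Membership.Propositional using (lose) renaming (_∈_ to _∈ₗ_)
open import Data.List.Membership.Propositional.Properties using (∈-map⁺; ∈-++⁺ˡ; ∈-++⁺ʳ)
open import Data.List.Relation.Unary.All using (All; []; _∷_)
open import Data.List.Relation.Unary.Any using (satisfied) renaming (here to hereₗ)
open import Data.List.Relation.Unary.Any.Properties using (any⁺; any⁻)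
open import Data.Product using (_×_; _,_; ∃; proj₁; proj₂; uncurry)
open import Data.Sum using (inj₁; inj₂)
open import Data.Empty using (⊥-elim)
open import Function using (_∘_; case_of_)
open import Function.Bundles using (mk⇔; Equivalence)
open import Relation.Nullary using (Dec; yes; no; does; ¬?)
open import Relation.Nullary.Decidable using (⌊_⌋; _×-dec_)
open import Relation.Binary.PropositionalEquality as ≡ using (_≡_; _≢_)

⌊⌋-true⁺ : ∀ {p} {P : Set p} (P? : Dec P) → P → ⌊ P? ⌋ ≡ true
⌊⌋-true⁺ (yes _) _ = ≡.refl
⌊⌋-true⁺ (no ¬p) p = ⊥-elim (¬p p)

⌊⌋-true⁻ : ∀ {p} {P : Set p} (P? : Dec P) → ⌊ P? ⌋ ≡ true → P
⌊⌋-true⁻ (yes p) _ = p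

∧-intro : ∀ {x y} → x ≡ true → y ≡ true → x ∧ y ≡ true
∧-intro ≡.refl ≡.refl = ≡.refl

∧-elim : ∀ {x y} → x ∧ y ≡ true → x ≡ true × y ≡ true
∧-elim {x} {y} e = ∧-conicalˡ x y e , ∧-conicalʳ x y e

≡true-ext : ∀ {x y} → (x ≡ true → y ≡ true) → (y ≡ true → x ≡ true) → x ≡ y
≡true-ext {true}  {true}  _   _   = ≡.refl
≡true-ext {false} {false} _   _   = ≡.refl
≡true-ext {true}  {false} x⇒y _   = ≡.sym (x⇒y ≡.refl)
≡true-ext {false} {true}  _   y⇒x = y⇒x ≡.refl

module _ {n : ℕ} where

  ∷-⊆⁺ : ∀ {s t} {p q : Subset n} → (s ≡ true → t ≡ true) → p ⊆ q → s ∷ p ⊆ t ∷ q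
  ∷-⊆⁺ {true} s⇒t p⊆q here with s⇒t ≡.refl
  ... | ≡.refl = here
  ∷-⊆⁺ s⇒t p⊆q (there x∈p) = there (p⊆q x∈p)

  ∷-⊆⁻ : ∀ {s t} {p q : Subset n} → s ∷ p ⊆ t ∷ q → s ≡ true → t ≡ true
  ∷-⊆⁻ {t = true}  _   _    = ≡.refl
  ∷-⊆⁻ {t = false} s⊆t ≡.refl with s⊆t here
  ... | ()

∪-least : ∀ {n} {p q r : Subset n} → p ⊆ r → q ⊆ r → p ∪ q ⊆ r
∪-least {p = p} {q} p⊆r q⊆r x∈p∪q with x∈p∪q⁻ p q x∈p∪q
... | inj₁ x∈p = p⊆r x∈p
... | inj₂ x∈q = q⊆r x∈q

∩-greatest : ∀ {n} {p q r : Subset n} → r ⊆ p → r ⊆ q → r ⊆ p ∩ q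
∩-greatest r⊆p r⊆q x∈r = x∈p∩q⁺ (r⊆p x∈r , r⊆q x∈r)

x∈p⇒⁅x⁆⊆p : ∀ {n} {x : Fin n} {p : Subset n} → x ∈ p → ⁅ x ⁆ ⊆ p
x∈p⇒⁅x⁆⊆p {x = x} x∈p y∈⁅x⁆ = ≡.subst (_∈ _) (≡.sym (x∈⁅y⁆⇒x≡y x y∈⁅x⁆)) x∈p

p⊆q⇒p∩q≡p : ∀ {n} {p q : Subset n} → p ⊆ q → p ∩ q ≡ p
p⊆q⇒p∩q≡p {p = p} {q} p⊆q = ⊆-antisym (p∩q⊆p p q) (∩-greatest ⊆-refl p⊆q)

p⊆q⇒q∩p≡p : ∀ {n} {p q : Subset n} → p ⊆ q → q ∩ p ≡ p
p⊆q⇒q∩p≡p {p = p} {q} p⊆q = ⊆-antisym (p∩q⊆q q p) (∩-greatest p⊆q ⊆-refl)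

x∈q⇒[p∪⁅x⁆]∩q≡p∩q∪⁅x⁆ : ∀ {n} (p : Subset n) {q x} → x ∈ q → (p ∪ ⁅ x ⁆) ∩ q ≡ (p ∩ q) ∪ ⁅ x ⁆
x∈q⇒[p∪⁅x⁆]∩q≡p∩q∪⁅x⁆ p {q} {x} x∈q =
  ≡.trans (∩-distribʳ-∪ q p ⁅ x ⁆) (≡.cong ((p ∩ q) ∪_) (p⊆q⇒p∩q≡p (x∈p⇒⁅x⁆⊆p x∈q)))

x∉q⇒[p∪⁅x⁆]∩q≡p∩q : ∀ {n} (p : Subset n) {q x} → x ∉ q → (p ∪ ⁅ x ⁆) ∩ q ≡ p ∩ q
x∉q⇒[p∪⁅x⁆]∩q≡p∩q p {q} {x} x∉q =
  ≡.trans (∩-distribʳ-∪ q p ⁅ x ⁆) (≡.trans (≡.cong ((p ∩ q) ∪_) ⁅x⁆∩q≡⊥) (∪-identityʳ (p ∩ q)))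
  where
  ⁅x⁆∩q≡⊥ : ⁅ x ⁆ ∩ q ≡ ⊥
  ⁅x⁆∩q≡⊥ = Empty-unique λ { (y , y∈) → x∉q (≡.subst (_∈ q) (x∈⁅y⁆⇒x≡y x (p∩q⊆p _ _ y∈)) (p∩q⊆q _ _ y∈)) }

x∉p⇒∣p∣<∣p∪⁅x⁆∣ : ∀ {n} {p : Subset n} {x} → x ∉ p → ∣ p ∣ < ∣ p ∪ ⁅ x ⁆ ∣
x∉p⇒∣p∣<∣p∪⁅x⁆∣ {p = p} {x} x∉p = p⊂q⇒∣p∣<∣q∣ (p⊆p∪q ⁅ x ⁆ , x , q⊆p∪q p ⁅ x ⁆ (x∈⁅x⁆ x) , x∉p)

p─p≡⊥ : ∀ {n} (p : Subset n) → p ─ p ≡ ⊥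
p─p≡⊥ []            = ≡.refl
p─p≡⊥ (inside  ∷ p) = ≡.cong (outside ∷_) (p─p≡⊥ p)
p─p≡⊥ (outside ∷ p) = ≡.cong (outside ∷_) (p─p≡⊥ p)

q⊆p⇒p─q∪q≡p : ∀ {n} (p q : Subset n) → q ⊆ p → (p ─ q) ∪ q ≡ p
q⊆p⇒p─q∪q≡p []      []            _   = ≡.refl
q⊆p⇒p─q∪q≡p (s ∷ p) (inside ∷ q)  q⊆p with ∷-⊆⁻ q⊆p ≡.refl
... | ≡.refl = ≡.cong (inside ∷_) (q⊆p⇒p─q∪q≡p p q (drop-∷-⊆ q⊆p))
q⊆p⇒p─q∪q≡p (s ∷ p) (outside ∷ q) q⊆p =
  ≡.cong₂ _∷_ (∨-identityʳ s) (q⊆p⇒p─q∪q≡p p q (drop-∷-⊆ q⊆p))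

─-monoˡ-⊆ : ∀ {n} {p q : Subset n} (r : Subset n) → p ⊆ q → p ─ r ⊆ q ─ r
─-monoˡ-⊆ {p = []}    {[]}    []            p⊆q = p⊆q
─-monoˡ-⊆ {p = _ ∷ p} {_ ∷ q} (inside ∷ r)  p⊆q = ∷-⊆⁺ (λ ()) (─-monoˡ-⊆ r (drop-∷-⊆ p⊆q))
─-monoˡ-⊆ {p = _ ∷ p} {_ ∷ q} (outside ∷ r) p⊆q = ∷-⊆⁺ (∷-⊆⁻ p⊆q) (─-monoˡ-⊆ r (drop-∷-⊆ p⊆q))

─-cancelˡ-⊆ : ∀ {n} {p q r : Subset n} → r ⊆ p → r ⊆ q → p ─ r ⊆ q ─ r → p ⊆ q
─-cancelˡ-⊆ {p = []}    {[]}    {[]}          _   _   p⊆q = p⊆q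
─-cancelˡ-⊆ {p = _ ∷ p} {_ ∷ q} {inside ∷ r}  r⊆p r⊆q p⊆q =
  ∷-⊆⁺ (λ _ → ∷-⊆⁻ r⊆q ≡.refl) (─-cancelˡ-⊆ (drop-∷-⊆ r⊆p) (drop-∷-⊆ r⊆q) (drop-∷-⊆ p⊆q))
─-cancelˡ-⊆ {p = _ ∷ p} {_ ∷ q} {outside ∷ r} r⊆p r⊆q p⊆q =
  ∷-⊆⁺ (∷-⊆⁻ p⊆q) (─-cancelˡ-⊆ (drop-∷-⊆ r⊆p) (drop-∷-⊆ r⊆q) (drop-∷-⊆ p⊆q))

∩-distribʳ-─ : ∀ {n} (p q r : Subset n) → (p ∩ q) ─ r ≡ (p ─ r) ∩ (q ─ r)
∩-distribʳ-─ []      []      []            = ≡.refl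
∩-distribʳ-─ (s ∷ p) (t ∷ q) (inside ∷ r)  = ≡.cong (outside ∷_) (∩-distribʳ-─ p q r)
∩-distribʳ-─ (s ∷ p) (t ∷ q) (outside ∷ r) = ≡.cong ((s ∧ t) ∷_) (∩-distribʳ-─ p q r)

x∉q⇒p∪⁅x⁆─q≡p─q∪⁅x⁆ : ∀ {n} (p q : Subset n) {x : Fin n} → x ∉ q → (p ∪ ⁅ x ⁆) ─ q ≡ (p ─ q) ∪ ⁅ x ⁆
x∉q⇒p∪⁅x⁆─q≡p─q∪⁅x⁆ (s ∷ p) (inside ∷ q)  {zero}  x∉q = ⊥-elim (x∉q here)
x∉q⇒p∪⁅x⁆─q≡p─q∪⁅x⁆ (s ∷ p) (outside ∷ q) {zero}  x∉q =
  ≡.cong ((s ∨ true) ∷_) (≡.trans (≡.cong (_─ q) (∪-identityʳ p)) (≡.sym (∪-identityʳ (p ─ q))))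
x∉q⇒p∪⁅x⁆─q≡p─q∪⁅x⁆ (s ∷ p) (inside ∷ q)  {suc x} x∉q =
  ≡.cong (outside ∷_) (x∉q⇒p∪⁅x⁆─q≡p─q∪⁅x⁆ p q (x∉q ∘ there))
x∉q⇒p∪⁅x⁆─q≡p─q∪⁅x⁆ (s ∷ p) (outside ∷ q) {suc x} x∉q =
  ≡.cong ((s ∨ false) ∷_) (x∉q⇒p∪⁅x⁆─q≡p─q∪⁅x⁆ p q (x∉q ∘ there))

r⊆q⇒p─r─[q─r]≡p─q : ∀ {n} (p q r : Subset n) → r ⊆ q → (p ─ r) ─ (q ─ r) ≡ p ─ q
r⊆q⇒p─r─[q─r]≡p─q []      []            []            _   = ≡.refl
r⊆q⇒p─r─[q─r]≡p─q (s ∷ p) (t ∷ q)       (inside ∷ r)  r⊆q with ∷-⊆⁻ r⊆q ≡.refl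
... | ≡.refl = ≡.cong (outside ∷_) (r⊆q⇒p─r─[q─r]≡p─q p q r (drop-∷-⊆ r⊆q))
r⊆q⇒p─r─[q─r]≡p─q (s ∷ p) (inside ∷ q)  (outside ∷ r) r⊆q =
  ≡.cong (outside ∷_) (r⊆q⇒p─r─[q─r]≡p─q p q r (drop-∷-⊆ r⊆q))
r⊆q⇒p─r─[q─r]≡p─q (s ∷ p) (outside ∷ q) (outside ∷ r) r⊆q =
  ≡.cong (s ∷_) (r⊆q⇒p─r─[q─r]≡p─q p q r (drop-∷-⊆ r⊆q))

p─q≡⊥⇒p⊆q : ∀ {n} {p q : Subset n} → p ─ q ≡ ⊥ → p ⊆ q
p─q≡⊥⇒p⊆q {p = []}          {[]}          _  = ⊆-refl
p─q≡⊥⇒p⊆q {p = _ ∷ p}       {inside ∷ q}  eq = ∷-⊆⁺ (λ _ → ≡.refl) (p─q≡⊥⇒p⊆q (∷-injectiveʳ eq))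
p─q≡⊥⇒p⊆q {p = outside ∷ p} {outside ∷ q} eq = ∷-⊆⁺ (λ ()) (p─q≡⊥⇒p⊆q (∷-injectiveʳ eq))

take-++ : ∀ {n m} (p : Subset n) (q : Subset m) → take n (p ++ q) ≡ p
take-++ []      q = ≡.refl
take-++ (s ∷ p) q = ≡.cong (s ∷_) (take-++ p q)

drop-++ : ∀ {n m} (p : Subset n) (q : Subset m) → drop n (p ++ q) ≡ q
drop-++ []      q = ≡.refl
drop-++ (s ∷ p) q = drop-++ p q

data Split (n m : ℕ) : Subset (n +ℕ m) → Set where
  _⊕_ : (p : Subset n) (q : Subset m) → Split n m (p ++ q)

split : ∀ n {m} (r : Subset (n +ℕ m)) → Split n m r
split n r = ≡.subst (Split n _) (take++drop≡id n r) (take n r ⊕ drop n r)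

++-∪ : ∀ {n m} (p p′ : Subset n) (q q′ : Subset m) → (p ++ q) ∪ (p′ ++ q′) ≡ (p ∪ p′) ++ (q ∪ q′)
++-∪ []      []       q q′ = ≡.refl
++-∪ (s ∷ p) (s′ ∷ p′) q q′ = ≡.cong ((s ∨ s′) ∷_) (++-∪ p p′ q q′)

++-∩ : ∀ {n m} (p p′ : Subset n) (q q′ : Subset m) → (p ++ q) ∩ (p′ ++ q′) ≡ (p ∩ p′) ++ (q ∩ q′)
++-∩ []      []       q q′ = ≡.refl
++-∩ (s ∷ p) (s′ ∷ p′) q q′ = ≡.cong ((s ∧ s′) ∷_) (++-∩ p p′ q q′)

++-─ : ∀ {n m} (p p′ : Subset n) (q q′ : Subset m) → (p ++ q) ─ (p′ ++ q′) ≡ (p ─ p′) ++ (q ─ q′)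
++-─ []      []            q q′ = ≡.refl
++-─ (s ∷ p) (inside ∷ p′)  q q′ = ≡.cong (outside ∷_) (++-─ p p′ q q′)
++-─ (s ∷ p) (outside ∷ p′) q q′ = ≡.cong (s ∷_) (++-─ p p′ q q′)

⊥-++ : ∀ n {m} → ⊥ {n +ℕ m} ≡ ⊥ {n} ++ ⊥ {m}
⊥-++ zero    = ≡.refl
⊥-++ (suc n) = ≡.cong (outside ∷_) (⊥-++ n)

++-⊆⁺ : ∀ {n m} {p p′ : Subset n} {q q′ : Subset m} → p ⊆ p′ → q ⊆ q′ → p ++ q ⊆ p′ ++ q′
++-⊆⁺ {p = []}    {[]}    _    q⊆q′ = q⊆q′
++-⊆⁺ {p = _ ∷ p} {_ ∷ p′} p⊆p′ q⊆q′ = ∷-⊆⁺ (∷-⊆⁻ p⊆p′) (++-⊆⁺ (drop-∷-⊆ p⊆p′) q⊆q′)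

++-⊆⁻ˡ : ∀ {n m} (p p′ : Subset n) {q q′ : Subset m} → p ++ q ⊆ p′ ++ q′ → p ⊆ p′
++-⊆⁻ˡ []      []       _ = ⊆-refl
++-⊆⁻ˡ (s ∷ p) (s′ ∷ p′) ⊆ = ∷-⊆⁺ (∷-⊆⁻ ⊆) (++-⊆⁻ˡ p p′ (drop-∷-⊆ ⊆))

++-⊆⁻ʳ : ∀ {n m} (p p′ : Subset n) {q q′ : Subset m} → p ++ q ⊆ p′ ++ q′ → q ⊆ q′
++-⊆⁻ʳ []      []       ⊆ = ⊆
++-⊆⁻ʳ (s ∷ p) (s′ ∷ p′) ⊆ = ++-⊆⁻ʳ p p′ (drop-∷-⊆ ⊆)

⁅↑ˡ⁆ : ∀ {n} m (x : Fin n) → ⁅ x ↑ˡ m ⁆ ≡ ⁅ x ⁆ ++ ⊥ {m}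
⁅↑ˡ⁆ {suc n} m zero    = ≡.cong (inside ∷_) (⊥-++ n)
⁅↑ˡ⁆         m (suc x) = ≡.cong (outside ∷_) (⁅↑ˡ⁆ m x)

⁅↑ʳ⁆ : ∀ n {m} (y : Fin m) → ⁅ n ↑ʳ y ⁆ ≡ ⊥ {n} ++ ⁅ y ⁆
⁅↑ʳ⁆ zero    y = ≡.refl
⁅↑ʳ⁆ (suc n) y = ≡.cong (outside ∷_) (⁅↑ʳ⁆ n y)

++-∪⁅↑ˡ⁆ : ∀ {n m} (p : Subset n) (q : Subset m) x → (p ++ q) ∪ ⁅ x ↑ˡ m ⁆ ≡ (p ∪ ⁅ x ⁆) ++ q
++-∪⁅↑ˡ⁆ {m = m} p q x = ≡.trans (≡.cong ((p ++ q) ∪_) (⁅↑ˡ⁆ m x))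
  (≡.trans (++-∪ p ⁅ x ⁆ q ⊥) (≡.cong ((p ∪ ⁅ x ⁆) ++_) (∪-identityʳ q)))

++-∪⁅↑ʳ⁆ : ∀ {n m} (p : Subset n) (q : Subset m) y → (p ++ q) ∪ ⁅ n ↑ʳ y ⁆ ≡ p ++ (q ∪ ⁅ y ⁆)
++-∪⁅↑ʳ⁆ {n} p q y = ≡.trans (≡.cong ((p ++ q) ∪_) (⁅↑ʳ⁆ n y))
  (≡.trans (++-∪ p ⊥ q ⁅ y ⁆) (≡.cong (_++ (q ∪ ⁅ y ⁆)) (∪-identityʳ p)))

↑ˡ-∈⁺ : ∀ {n m} {p : Subset n} {q : Subset m} {x : Fin n} → x ∈ p → x ↑ˡ m ∈ p ++ q
↑ˡ-∈⁺ here       = here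
↑ˡ-∈⁺ (there x∈) = there (↑ˡ-∈⁺ x∈)

↑ˡ-∈⁻ : ∀ {n m} {p : Subset n} {q : Subset m} {x : Fin n} → x ↑ˡ m ∈ p ++ q → x ∈ p
↑ˡ-∈⁻ {p = _ ∷ _} {x = zero}  here       = here
↑ˡ-∈⁻ {p = _ ∷ _} {x = suc x} (there x∈) = there (↑ˡ-∈⁻ x∈)

↑ʳ-∈⁺ : ∀ {n m} (p : Subset n) {q : Subset m} {y : Fin m} → y ∈ q → n ↑ʳ y ∈ p ++ q
↑ʳ-∈⁺ []      y∈ = y∈
↑ʳ-∈⁺ (_ ∷ p) y∈ = there (↑ʳ-∈⁺ p y∈)

↑ʳ-∈⁻ : ∀ {n m} (p : Subset n) {q : Subset m} {y : Fin m} → n ↑ʳ y ∈ p ++ q → y ∈ q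
↑ʳ-∈⁻ []      y∈         = y∈
↑ʳ-∈⁻ (_ ∷ p) (there y∈) = ↑ʳ-∈⁻ p y∈

∈-allSubsets : ∀ {n} (p : Subset n) → p ∈ₗ allSubsets n
∈-allSubsets []            = hereₗ ≡.refl
∈-allSubsets {suc n} (outside ∷ p) = ∈-++⁺ˡ (∈-map⁺ (outside ∷_) (∈-allSubsets p))
∈-allSubsets {suc n} (inside ∷ p)  =
  ∈-++⁺ʳ (map (outside ∷_) (allSubsets n)) (∈-map⁺ (inside ∷_) (∈-allSubsets p))

anySubset-intro : ∀ {n} (f : Subset n → Bool) p → f p ≡ true → any f (allSubsets n) ≡ true
anySubset-intro f p fp = Equivalence.to T-≡ (any⁺ f (lose (∈-allSubsets p) (Equivalence.from T-≡ fp)))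

anySubset-elim : ∀ {n} (f : Subset n → Bool) → any f (allSubsets n) ≡ true → ∃ λ p → f p ≡ true
anySubset-elim {n} f any≡ with satisfied (any⁻ f (allSubsets n) (Equivalence.from T-≡ any≡))
... | p , fp = p , Equivalence.to T-≡ fp

minor-closed⁺ : ∀ G {A B W Y : Subset (n G)} → Closed G W → A ⊆ W → W ⊆ B → W ─ A ≡ Y →
                Closed (minor G A B) Y
minor-closed⁺ G {A} {B} {W} cW A⊆W W⊆B ≡.refl = anySubset-intro _ W
  (∧-intro cW (∧-intro (⌊⌋-true⁺ (A ⊆? W) A⊆W) (∧-intro (⌊⌋-true⁺ (W ⊆? B) W⊆B) (⌊⌋-true⁺ (_ ≟ˢ _) ≡.refl))))

record MinorPreimage (G : SetSystem) (A B Y : Subset (n G)) : Set where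
  constructor preimage
  field
    W      : Subset (n G)
    closed : Closed G W
    A⊆W    : A ⊆ W
    W⊆B    : W ⊆ B
    W─A≡Y  : W ─ A ≡ Y

minor-closed⁻ : ∀ G A B {Y : Subset (n G)} → Closed (minor G A B) Y → MinorPreimage G A B Y
minor-closed⁻ G A B {Y} cY with anySubset-elim _ cY
... | W , e with ∧-elim e
... | cW , e′ with ∧-elim e′
... | A⊆W , e″ with ∧-elim e″
... | W⊆B , W─A≡Y = preimage W cW (⌊⌋-true⁻ (A ⊆? W) A⊆W) (⌊⌋-true⁻ (W ⊆? B) W⊆B) (⌊⌋-true⁻ (_ ≟ˢ Y) W─A≡Y)

product-closed⁺ : ∀ G H {p : Subset (n G)} {q : Subset (n H)} → Closed G p → Closed H q →
                  Closed (product G H) (p ++ q)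
product-closed⁺ G H {p} {q} cp cq rewrite take-++ p q | drop-++ p q = ∧-intro cp cq

product-closed⁻ : ∀ G H {p : Subset (n G)} {q : Subset (n H)} → Closed (product G H) (p ++ q) →
                  Closed G p × Closed H q
product-closed⁻ G H {p} {q} c rewrite take-++ p q | drop-++ p q = ∧-elim c

-- Minors and products of convex geometries

module _ {G : SetSystem} (cg : IsConvexGeometry G) where
  open IsConvexGeometry cg

  -- Grow V ⊇ W by single-element extensions in G while keeping V ∩ B = W; the first
  -- added element that lies in B extends W inside B, and the fuel k bounds the growth.
  private
    grow : ∀ {B W V} → Closed G B → W ≢ B → Closed G V → V ∩ B ≡ W →
           ∀ k → n G ≤ ∣ V ∣ +ℕ k → ∃ λ z → z ∈ B × z ∉ W × Closed G (W ∪ ⁅ z ⁆)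
    grow {B} {W} {V} cB W≢B cV V∩B≡W k bound with V ≟ˢ Z G
    ... | yes ≡.refl = ⊥-elim (W≢B (≡.trans (≡.sym V∩B≡W) (p⊆q⇒q∩p≡p (closed⊆Z B cB))))
    ... | no V≢Z with extension V cV V≢Z
    ... | v , _ , v∉V , cV∪v with v ∈? B
    ... | yes v∈B =
      v , v∈B , (λ v∈W → v∉V (p∩q⊆p V B (≡.subst (v ∈_) (≡.sym V∩B≡W) v∈W))) ,
      ≡.subst (Closed G) (≡.trans (x∈q⇒[p∪⁅x⁆]∩q≡p∩q∪⁅x⁆ V v∈B) (≡.cong (_∪ ⁅ v ⁆) V∩B≡W))
              (∩-closed _ B cV∪v cB)
    ... | no v∉B with k
    ... | zero = ⊥-elim (ℕ.<⇒≱ (ℕ.<-≤-trans (x∉p⇒∣p∣<∣p∪⁅x⁆∣ v∉V) (∣p∣≤n (V ∪ ⁅ v ⁆)))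
                              (≡.subst (n G ≤_) (ℕ.+-identityʳ _) bound))
    ... | suc k = grow cB W≢B cV∪v (≡.trans (x∉q⇒[p∪⁅x⁆]∩q≡p∩q V v∉B) V∩B≡W) k
                    (ℕ.≤-trans bound (≡.subst (_≤ ∣ V ∪ ⁅ v ⁆ ∣ +ℕ k) (≡.sym (ℕ.+-suc ∣ V ∣ k))
                                          (ℕ.+-monoˡ-≤ k (x∉p⇒∣p∣<∣p∪⁅x⁆∣ v∉V))))

  extension-within : ∀ {B W} → Closed G B → Closed G W → W ⊆ B → W ≢ B →
                     ∃ λ z → z ∈ B × z ∉ W × Closed G (W ∪ ⁅ z ⁆)
  extension-within {B} {W} cB cW W⊆B W≢B = grow cB W≢B cW (p⊆q⇒p∩q≡p W⊆B) (n G) (ℕ.m≤n+m (n G) ∣ W ∣)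

minor-isConvexGeometry : ∀ {G A B} → IsConvexGeometry G → Closed G A → Closed G B → A ⊆ B →
                         IsConvexGeometry (minor G A B)
minor-isConvexGeometry {G} {A} {B} cg cA cB A⊆B = record
  { closed⊆Z  = closed⊆Z′
  ; ∅-closed  = minor-closed⁺ G cA ⊆-refl A⊆B (p─p≡⊥ A)
  ; Z-closed  = minor-closed⁺ G cB A⊆B ⊆-refl ≡.refl
  ; ∩-closed  = ∩-closed′
  ; extension = extension′
  }
  where
  open IsConvexGeometry cg

  closed⊆Z′ : ∀ Y → Closed (minor G A B) Y → Y ⊆ B ─ A
  closed⊆Z′ Y cY with minor-closed⁻ G A B cY
  ... | preimage W _ _ W⊆B ≡.refl = ─-monoˡ-⊆ A W⊆B

  ∩-closed′ : ∀ Y Y′ → Closed (minor G A B) Y → Closed (minor G A B) Y′ → Closed (minor G A B) (Y ∩ Y′)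
  ∩-closed′ Y Y′ cY cY′ with minor-closed⁻ G A B cY | minor-closed⁻ G A B cY′
  ... | preimage W cW A⊆W W⊆B ≡.refl | preimage W′ cW′ A⊆W′ W′⊆B ≡.refl =
    minor-closed⁺ G (∩-closed W W′ cW cW′) (∩-greatest A⊆W A⊆W′) (⊆-trans (p∩q⊆p W W′) W⊆B)
      (∩-distribʳ-─ W W′ A)

  extension′ : ∀ Y → Closed (minor G A B) Y → Y ≢ B ─ A →
               ∃ λ z → z ∈ B ─ A × z ∉ Y × Closed (minor G A B) (Y ∪ ⁅ z ⁆)
  extension′ Y cY Y≢B─A with minor-closed⁻ G A B cY
  ... | preimage W cW A⊆W W⊆B ≡.refl with extension-within cg cB cW W⊆B (Y≢B─A ∘ ≡.cong (_─ A))
  ... | z , z∈B , z∉W , cW∪z =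
    z , x∈p∧x∉q⇒x∈p─q z∈B (z∉W ∘ A⊆W) , z∉W ∘ p─q⊆p W A ,
    minor-closed⁺ G cW∪z (⊆-trans A⊆W (p⊆p∪q ⁅ z ⁆)) (∪-least W⊆B (x∈p⇒⁅x⁆⊆p z∈B))
      (x∉q⇒p∪⁅x⁆─q≡p─q∪⁅x⁆ W A (z∉W ∘ A⊆W))

product-isConvexGeometry : ∀ {G H} → IsConvexGeometry G → IsConvexGeometry H → IsConvexGeometry (product G H)
product-isConvexGeometry {G} {H} cg ch = record
  { closed⊆Z  = closed⊆Z′
  ; ∅-closed  = ≡.subst (Closed (product G H)) (≡.sym (⊥-++ (n G))) (product-closed⁺ G H G.∅-closed H.∅-closed)
  ; Z-closed  = product-closed⁺ G H G.Z-closed H.Z-closed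
  ; ∩-closed  = ∩-closed′
  ; extension = extension′
  }
  where
  module G = IsConvexGeometry cg
  module H = IsConvexGeometry ch

  closed⊆Z′ : ∀ X → Closed (product G H) X → X ⊆ Z G ++ Z H
  closed⊆Z′ X cX with split (n G) X
  ... | p ⊕ q with product-closed⁻ G H cX
  ... | cp , cq = ++-⊆⁺ (G.closed⊆Z p cp) (H.closed⊆Z q cq)

  ∩-closed′ : ∀ X Y → Closed (product G H) X → Closed (product G H) Y → Closed (product G H) (X ∩ Y)
  ∩-closed′ X Y cX cY with split (n G) X | split (n G) Y
  ... | p ⊕ q | p′ ⊕ q′ with product-closed⁻ G H cX | product-closed⁻ G H cY
  ... | cp , cq | cp′ , cq′ = ≡.subst (Closed (product G H)) (≡.sym (++-∩ p p′ q q′))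
    (product-closed⁺ G H (G.∩-closed p p′ cp cp′) (H.∩-closed q q′ cq cq′))

  extension′ : ∀ X → Closed (product G H) X → X ≢ Z G ++ Z H →
               ∃ λ z → z ∈ Z G ++ Z H × z ∉ X × Closed (product G H) (X ∪ ⁅ z ⁆)
  extension′ X cX X≢Z with split (n G) X
  ... | p ⊕ q with product-closed⁻ G H cX | p ≟ˢ Z G
  ... | cp , cq | no p≢Z with G.extension p cp p≢Z
  ... | x , x∈Z , x∉p , cp∪x =
    x ↑ˡ n H , ↑ˡ-∈⁺ x∈Z , x∉p ∘ ↑ˡ-∈⁻ ,
    ≡.subst (Closed (product G H))
      (≡.sym (++-∪⁅↑ˡ⁆ p q x))
      (product-closed⁺ G H cp∪x cq)
  extension′ X cX X≢Z | p ⊕ q | cp , cq | yes ≡.refl with H.extension q cq (X≢Z ∘ ≡.cong (Z G ++_))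
  ... | y , y∈Z , y∉q , cq∪y =
    n G ↑ʳ y , ↑ʳ-∈⁺ (Z G) y∈Z , y∉q ∘ ↑ʳ-∈⁻ (Z G) ,
    ≡.subst (Closed (product G H))
      (≡.sym (++-∪⁅↑ʳ⁆ (Z G) q y))
      (product-closed⁺ G H G.Z-closed cq∪y)

-- Lattice isomorphisms

module _ {G H : SetSystem} where

  mkIso : (to : Subset (n G) → Subset (n H)) (from : Subset (n H) → Subset (n G)) →
          (∀ X → Closed G X → Closed H (to X)) → (∀ Y → Closed H Y → Closed G (from Y)) →
          (∀ X → Closed G X → from (to X) ≡ X) → (∀ Y → Closed H Y → to (from Y) ≡ Y) →
          (∀ X X′ → Closed G X → Closed G X′ → X ⊆ X′ → to X ⊆ to X′) →
          (∀ Y Y′ → Closed H Y → Closed H Y′ → Y ⊆ Y′ → from Y ⊆ from Y′) →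
          Iso G H
  mkIso to from to-cl from-cl from-to to-from to-mono from-mono = record
    { to = to ; from = from ; to-cl = to-cl ; from-cl = from-cl ; from-to = from-to ; to-from = to-from
    ; order = λ X X′ cX cX′ → mk⇔ (to-mono X X′ cX cX′) λ tX⊆tX′ →
        ≡.subst₂ _⊆_ (from-to X cX) (from-to X′ cX′) (from-mono _ _ (to-cl X cX) (to-cl X′ cX′) tX⊆tX′)
    }

  Iso-from-mono : (i : Iso G H) → ∀ Y Y′ → Closed H Y → Closed H Y′ → Y ⊆ Y′ → Iso.from i Y ⊆ Iso.from i Y′
  Iso-from-mono i Y Y′ cY cY′ Y⊆Y′ = Equivalence.from (order (from Y) (from Y′) (from-cl Y cY) (from-cl Y′ cY′))
    (≡.subst₂ _⊆_ (≡.sym (to-from Y cY)) (≡.sym (to-from Y′ cY′)) Y⊆Y′)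
    where open Iso i

Iso-sym : ∀ {G H} → Iso G H → Iso H G
Iso-sym i = mkIso from to from-cl to-cl to-from from-to
  (Iso-from-mono i) (λ X X′ cX cX′ → Equivalence.to (order X X′ cX cX′))
  where open Iso i

sameClosedSets⇒Iso : ∀ {m Z Z′} {E E′ : Subset m → Bool} →
                     (∀ X → E X ≡ true → E′ X ≡ true) → (∀ X → E′ X ≡ true → E X ≡ true) →
                     Iso (setSystem m Z E) (setSystem m Z′ E′)
sameClosedSets⇒Iso E⇒E′ E′⇒E =
  mkIso (λ X → X) (λ X → X) E⇒E′ E′⇒E (λ _ _ → ≡.refl) (λ _ _ → ≡.refl) (λ _ _ _ _ ⊆ → ⊆) (λ _ _ _ _ ⊆ → ⊆)

Iso-refl : ∀ G → Iso G G
Iso-refl G = sameClosedSets⇒Iso (λ _ c → c) (λ _ c → c)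

module _ {G G′ H H′ : SetSystem} (i : Iso G G′) (j : Iso H H′) where
  private
    module i = Iso i
    module j = Iso j

  ⊗-to : Subset (n G +ℕ n H) → Subset (n G′ +ℕ n H′)
  ⊗-to X = i.to (take (n G) X) ++ j.to (drop (n G) X)

  ⊗-to-++ : ∀ p q → ⊗-to (p ++ q) ≡ i.to p ++ j.to q
  ⊗-to-++ p q = ≡.cong₂ (λ p q → i.to p ++ j.to q) (take-++ p q) (drop-++ p q)

  ⊗-to-closed : ∀ X → Closed (product G H) X → Closed (product G′ H′) (⊗-to X)
  ⊗-to-closed X cX with split (n G) X
  ... | p ⊕ q with product-closed⁻ G H cX
  ... | cp , cq = ≡.subst (Closed (product G′ H′)) (≡.sym (⊗-to-++ p q))
                         (product-closed⁺ G′ H′ (i.to-cl p cp) (j.to-cl q cq))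

  ⊗-to-mono : ∀ X X′ → Closed (product G H) X → Closed (product G H) X′ → X ⊆ X′ → ⊗-to X ⊆ ⊗-to X′
  ⊗-to-mono X X′ cX cX′ X⊆X′ with split (n G) X | split (n G) X′
  ... | p ⊕ q | p′ ⊕ q′ with product-closed⁻ G H cX | product-closed⁻ G H cX′
  ... | cp , cq | cp′ , cq′ = ≡.subst₂ _⊆_ (≡.sym (⊗-to-++ p q)) (≡.sym (⊗-to-++ p′ q′))
    (++-⊆⁺ (Equivalence.to (i.order p p′ cp cp′) (++-⊆⁻ˡ p p′ X⊆X′))
           (Equivalence.to (j.order q q′ cq cq′) (++-⊆⁻ʳ p p′ X⊆X′)))

⊗-to-inverse : ∀ {G G′ H H′} (i : Iso G G′) (j : Iso H H′) →
               ∀ X → Closed (product G H) X → ⊗-to (Iso-sym i) (Iso-sym j) (⊗-to i j X) ≡ X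
⊗-to-inverse {G} {G′} {H} {H′} i j X cX with split (n G) X
... | p ⊕ q with product-closed⁻ G H cX
... | cp , cq = ≡.trans (≡.cong (⊗-to (Iso-sym i) (Iso-sym j)) (⊗-to-++ i j p q))
  (≡.trans (⊗-to-++ (Iso-sym i) (Iso-sym j) _ _) (≡.cong₂ _++_ (Iso.from-to i p cp) (Iso.from-to j q cq)))

product-Iso : ∀ {G G′ H H′} → Iso G G′ → Iso H H′ → Iso (product G H) (product G′ H′)
product-Iso i j = mkIso (⊗-to i j) (⊗-to i⁻¹ j⁻¹) (⊗-to-closed i j) (⊗-to-closed i⁻¹ j⁻¹)
                        (⊗-to-inverse i j) (⊗-to-inverse i⁻¹ j⁻¹) (⊗-to-mono i j) (⊗-to-mono i⁻¹ j⁻¹)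
  where
  i⁻¹ = Iso-sym i
  j⁻¹ = Iso-sym j

MapsInterval : ∀ {G G′} → Iso G G′ → (A B : Subset (n G)) (A′ B′ : Subset (n G′)) → Set
MapsInterval {G} i A B A′ B′ = ∀ W → Closed G W → A ⊆ W → W ⊆ B → A′ ⊆ Iso.to i W × Iso.to i W ⊆ B′

module _ {G G′ : SetSystem} (i : Iso G G′) {A B : Subset (n G)} {A′ B′ : Subset (n G′)}
         (interval : MapsInterval i A B A′ B′) where
  private
    module i = Iso i

  -- A closed set of M(A, B) is W ─ A with A ⊆ W, so W is recovered as Y ∪ A.
  minor-to : Subset (n G) → Subset (n G′)
  minor-to Y = i.to (Y ∪ A) ─ A′

  minor-to-preimage : ∀ {Y} (w : MinorPreimage G A B Y) → minor-to Y ≡ i.to (MinorPreimage.W w) ─ A′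
  minor-to-preimage (preimage W _ A⊆W _ ≡.refl) = ≡.cong (λ V → i.to V ─ A′) (q⊆p⇒p─q∪q≡p W A A⊆W)

  minor-to-closed : ∀ Y → Closed (minor G A B) Y → Closed (minor G′ A′ B′) (minor-to Y)
  minor-to-closed Y cY with minor-closed⁻ G A B cY
  ... | w@(preimage W cW A⊆W W⊆B _) =
    minor-closed⁺ G′ (i.to-cl W cW) (proj₁ (interval W cW A⊆W W⊆B)) (proj₂ (interval W cW A⊆W W⊆B))
      (≡.sym (minor-to-preimage w))

  minor-to-mono : ∀ Y Y′ → Closed (minor G A B) Y → Closed (minor G A B) Y′ → Y ⊆ Y′ → minor-to Y ⊆ minor-to Y′
  minor-to-mono Y Y′ cY cY′ Y⊆Y′ with minor-closed⁻ G A B cY | minor-closed⁻ G A B cY′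
  ... | w@(preimage W cW A⊆W _ ≡.refl) | w′@(preimage W′ cW′ A⊆W′ _ ≡.refl) =
    ≡.subst₂ _⊆_ (≡.sym (minor-to-preimage w)) (≡.sym (minor-to-preimage w′))
      (─-monoˡ-⊆ A′ (Equivalence.to (i.order W W′ cW cW′) (─-cancelˡ-⊆ A⊆W A⊆W′ Y⊆Y′)))

minor-to-inverse : ∀ {G G′} (i : Iso G G′) {A B A′ B′}
                   (interval : MapsInterval i A B A′ B′) (interval⁻¹ : MapsInterval (Iso-sym i) A′ B′ A B) →
                   ∀ Y → Closed (minor G A B) Y → minor-to (Iso-sym i) interval⁻¹ (minor-to i interval Y) ≡ Y
minor-to-inverse {G} i {A} {B} {A′} {B′} interval interval⁻¹ Y cY with minor-closed⁻ G A B cY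
... | w@(preimage W cW A⊆W W⊆B ≡.refl) = ≡.trans
  (≡.cong (minor-to (Iso-sym i) interval⁻¹) (minor-to-preimage i interval w))
  (≡.cong (_─ A) (≡.trans (≡.cong (Iso.from i) (q⊆p⇒p─q∪q≡p _ A′ (proj₁ (interval W cW A⊆W W⊆B))))
                          (Iso.from-to i W cW)))

minor-Iso : ∀ {G G′} (i : Iso G G′) {A B A′ B′} →
            MapsInterval i A B A′ B′ → MapsInterval (Iso-sym i) A′ B′ A B →
            Iso (minor G A B) (minor G′ A′ B′)
minor-Iso i interval interval⁻¹ = mkIso (minor-to i interval) (minor-to i⁻¹ interval⁻¹)
  (minor-to-closed i interval) (minor-to-closed i⁻¹ interval⁻¹)
  (minor-to-inverse i interval interval⁻¹) (minor-to-inverse i⁻¹ interval⁻¹ interval)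
  (minor-to-mono i interval) (minor-to-mono i⁻¹ interval⁻¹)
  where i⁻¹ = Iso-sym i

minor-minor-Iso : ∀ G {A A″ B″ B : Subset (n G)} → A ⊆ A″ → A″ ⊆ B″ → B″ ⊆ B →
                  Iso (minor (minor G A B) (A″ ─ A) (B″ ─ A)) (minor G A″ B″)
minor-minor-Iso G {A} {A″} {B″} {B} A⊆A″ A″⊆B″ B″⊆B = sameClosedSets⇒Iso to-cl from-cl
  where
  A⊆B″ = ⊆-trans A⊆A″ A″⊆B″
  to-cl : ∀ Y → Closed (minor (minor G A B) (A″ ─ A) (B″ ─ A)) Y → Closed (minor G A″ B″) Y
  to-cl Y cY with minor-closed⁻ (minor G A B) (A″ ─ A) (B″ ─ A) cY
  ... | preimage U cU A″─A⊆U U⊆B″─A U─[A″─A]≡Y with minor-closed⁻ G A B cU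
  ... | preimage W cW A⊆W _ ≡.refl =
    minor-closed⁺ G cW (─-cancelˡ-⊆ A⊆A″ A⊆W A″─A⊆U) (─-cancelˡ-⊆ A⊆W A⊆B″ U⊆B″─A)
      (≡.trans (≡.sym (r⊆q⇒p─r─[q─r]≡p─q W A″ A A⊆A″)) U─[A″─A]≡Y)
  from-cl : ∀ Y → Closed (minor G A″ B″) Y → Closed (minor (minor G A B) (A″ ─ A) (B″ ─ A)) Y
  from-cl Y cY with minor-closed⁻ G A″ B″ cY
  ... | preimage W cW A″⊆W W⊆B″ W─A″≡Y =
    minor-closed⁺ (minor G A B) (minor-closed⁺ G cW (⊆-trans A⊆A″ A″⊆W) (⊆-trans W⊆B″ B″⊆B) ≡.refl)
      (─-monoˡ-⊆ A A″⊆W) (─-monoˡ-⊆ A W⊆B″) (≡.trans (r⊆q⇒p─r─[q─r]≡p─q W A″ A A⊆A″) W─A″≡Y)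

minor-product-Iso : ∀ G H (A B : Subset (n G)) (A′ B′ : Subset (n H)) →
                    Iso (minor (product G H) (A ++ A′) (B ++ B′)) (product (minor G A B) (minor H A′ B′))
minor-product-Iso G H A B A′ B′ = sameClosedSets⇒Iso to-cl from-cl
  where
  minor-of-product product-of-minors : SetSystem
  minor-of-product  = minor (product G H) (A ++ A′) (B ++ B′)
  product-of-minors = product (minor G A B) (minor H A′ B′)
  to-cl : ∀ Y → Closed minor-of-product Y → Closed product-of-minors Y
  to-cl Y cY with minor-closed⁻ (product G H) (A ++ A′) (B ++ B′) cY
  ... | preimage W cW A⊆W W⊆B W─A≡Y with split (n G) W
  ... | p ⊕ q with product-closed⁻ G H cW
  ... | cp , cq = ≡.subst (Closed product-of-minors) (≡.trans (≡.sym (++-─ p A q A′)) W─A≡Y)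
    (product-closed⁺ (minor G A B) (minor H A′ B′)
      (minor-closed⁺ G cp (++-⊆⁻ˡ A p A⊆W) (++-⊆⁻ˡ p B W⊆B) ≡.refl)
      (minor-closed⁺ H cq (++-⊆⁻ʳ A p A⊆W) (++-⊆⁻ʳ p B W⊆B) ≡.refl))
  from-cl : ∀ Y → Closed product-of-minors Y → Closed minor-of-product Y
  from-cl Y cY with split (n G) Y
  ... | p ⊕ q with product-closed⁻ (minor G A B) (minor H A′ B′) {p} {q} cY
  ... | cp , cq with minor-closed⁻ G A B cp | minor-closed⁻ H A′ B′ cq
  ... | preimage W cW A⊆W W⊆B W─A≡p | preimage W′ cW′ A′⊆W′ W′⊆B′ W′─A′≡q =
    minor-closed⁺ (product G H) (product-closed⁺ G H cW cW′) (++-⊆⁺ A⊆W A′⊆W′) (++-⊆⁺ W⊆B W′⊆B′)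
      (≡.trans (++-─ W A W′ A′) (≡.cong₂ _++_ W─A≡p W′─A′≡q))

data Split₃ (a b c : ℕ) : Subset ((a +ℕ b) +ℕ c) → Set where
  split₃ : (p : Subset a) (q : Subset b) (r : Subset c) → Split₃ a b c ((p ++ q) ++ r)

data Split₃′ (a b c : ℕ) : Subset (a +ℕ (b +ℕ c)) → Set where
  split₃′ : (p : Subset a) (q : Subset b) (r : Subset c) → Split₃′ a b c (p ++ (q ++ r))

split-assocˡ : ∀ a b {c} (X : Subset ((a +ℕ b) +ℕ c)) → Split₃ a b c X
split-assocˡ a b X with split (a +ℕ b) X
... | pq ⊕ r with split a pq
... | p ⊕ q = split₃ p q r

split-assocʳ : ∀ a b {c} (X : Subset (a +ℕ (b +ℕ c))) → Split₃′ a b c X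
split-assocʳ a b X with split a X
... | p ⊕ qr with split b qr
... | q ⊕ r = split₃′ p q r

reassocʳ : ∀ a b {c} → Subset ((a +ℕ b) +ℕ c) → Subset (a +ℕ (b +ℕ c))
reassocʳ a b X = take a (take (a +ℕ b) X) ++ (drop a (take (a +ℕ b) X) ++ drop (a +ℕ b) X)

reassocˡ : ∀ a b {c} → Subset (a +ℕ (b +ℕ c)) → Subset ((a +ℕ b) +ℕ c)
reassocˡ a b Y = (take a Y ++ take b (drop a Y)) ++ drop b (drop a Y)

reassocʳ-++ : ∀ {a b c} (p : Subset a) (q : Subset b) (r : Subset c) →
              reassocʳ a b ((p ++ q) ++ r) ≡ p ++ (q ++ r)
reassocʳ-++ p q r rewrite take-++ (p ++ q) r | drop-++ (p ++ q) r | take-++ p q | drop-++ p q = ≡.refl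

reassocˡ-++ : ∀ {a b c} (p : Subset a) (q : Subset b) (r : Subset c) →
              reassocˡ a b (p ++ (q ++ r)) ≡ (p ++ q) ++ r
reassocˡ-++ p q r rewrite take-++ p (q ++ r) | drop-++ p (q ++ r) | take-++ q r | drop-++ q r = ≡.refl

reassocˡ∘reassocʳ : ∀ a b {c} (X : Subset ((a +ℕ b) +ℕ c)) → reassocˡ a b (reassocʳ a b X) ≡ X
reassocˡ∘reassocʳ a b X with split-assocˡ a b X
... | split₃ p q r = ≡.trans (≡.cong (reassocˡ a b) (reassocʳ-++ p q r)) (reassocˡ-++ p q r)

reassocʳ∘reassocˡ : ∀ a b {c} (Y : Subset (a +ℕ (b +ℕ c))) → reassocʳ a b (reassocˡ a b Y) ≡ Y
reassocʳ∘reassocˡ a b Y with split-assocʳ a b Y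
... | split₃′ p q r = ≡.trans (≡.cong (reassocʳ a b) (reassocˡ-++ p q r)) (reassocʳ-++ p q r)

reassocʳ-mono : ∀ a b {c} {X X′ : Subset ((a +ℕ b) +ℕ c)} → X ⊆ X′ → reassocʳ a b X ⊆ reassocʳ a b X′
reassocʳ-mono a b {X = X} {X′} X⊆X′ with split-assocˡ a b X | split-assocˡ a b X′
... | split₃ p q r | split₃ p′ q′ r′ = ≡.subst₂ _⊆_ (≡.sym (reassocʳ-++ p q r)) (≡.sym (reassocʳ-++ p′ q′ r′))
  (++-⊆⁺ (++-⊆⁻ˡ p p′ pq⊆pq′) (++-⊆⁺ (++-⊆⁻ʳ p p′ pq⊆pq′) (++-⊆⁻ʳ (p ++ q) (p′ ++ q′) X⊆X′)))
  where pq⊆pq′ = ++-⊆⁻ˡ (p ++ q) (p′ ++ q′) X⊆X′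

reassocˡ-mono : ∀ a b {c} {Y Y′ : Subset (a +ℕ (b +ℕ c))} → Y ⊆ Y′ → reassocˡ a b Y ⊆ reassocˡ a b Y′
reassocˡ-mono a b {Y = Y} {Y′} Y⊆Y′ with split-assocʳ a b Y | split-assocʳ a b Y′
... | split₃′ p q r | split₃′ p′ q′ r′ = ≡.subst₂ _⊆_ (≡.sym (reassocˡ-++ p q r)) (≡.sym (reassocˡ-++ p′ q′ r′))
  (++-⊆⁺ (++-⊆⁺ (++-⊆⁻ˡ p p′ Y⊆Y′) (++-⊆⁻ˡ q q′ qr⊆qr′)) (++-⊆⁻ʳ q q′ qr⊆qr′))
  where qr⊆qr′ = ++-⊆⁻ʳ p p′ Y⊆Y′

product-assoc-Iso : ∀ G H I → Iso (product (product G H) I) (product G (product H I))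
product-assoc-Iso G H I = mkIso (reassocʳ (n G) (n H)) (reassocˡ (n G) (n H)) to-cl from-cl
  (λ X _ → reassocˡ∘reassocʳ (n G) (n H) X) (λ Y _ → reassocʳ∘reassocˡ (n G) (n H) Y)
  (λ _ _ _ _ → reassocʳ-mono (n G) (n H)) (λ _ _ _ _ → reassocˡ-mono (n G) (n H))
  where
  to-cl : ∀ X → Closed (product (product G H) I) X → Closed (product G (product H I)) (reassocʳ (n G) (n H) X)
  to-cl X cX with split-assocˡ (n G) (n H) X
  ... | split₃ p q r with product-closed⁻ (product G H) I {p ++ q} {r} cX
  ... | cpq , cr with product-closed⁻ G H {p} {q} cpq
  ... | cp , cq = ≡.subst (Closed (product G (product H I))) (≡.sym (reassocʳ-++ p q r))
    (product-closed⁺ G (product H I) {p} {q ++ r} cp (product-closed⁺ H I cq cr))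
  from-cl : ∀ Y → Closed (product G (product H I)) Y → Closed (product (product G H) I) (reassocˡ (n G) (n H) Y)
  from-cl Y cY with split-assocʳ (n G) (n H) Y
  ... | split₃′ p q r with product-closed⁻ G (product H I) {p} {q ++ r} cY
  ... | cp , cqr with product-closed⁻ H I {q} {r} cqr
  ... | cq , cr = ≡.subst (Closed (product (product G H) I)) (≡.sym (reassocˡ-++ p q r))
    (product-closed⁺ (product G H) I {p ++ q} {r} (product-closed⁺ G H cp cq) cr)

product-identityˡ-Iso : ∀ G → Iso (product emptyGeometry G) G
product-identityˡ-Iso G = sameClosedSets⇒Iso {E = E G} (λ _ c → c) (λ _ c → c)

product-identityʳ-Iso : ∀ G → Iso (product G emptyGeometry) G
product-identityʳ-Iso G = mkIso (take (n G)) (_++ []) to-cl from-cl from-to to-from to-mono from-mono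
  where
  to-cl : ∀ X → Closed (product G emptyGeometry) X → Closed G (take (n G) X)
  to-cl X cX with split (n G) X
  ... | p ⊕ [] = ≡.subst (Closed G) (≡.sym (take-++ p [])) (proj₁ (product-closed⁻ G emptyGeometry cX))
  from-cl : ∀ X → Closed G X → Closed (product G emptyGeometry) (X ++ [])
  from-cl X cX = product-closed⁺ G emptyGeometry cX ≡.refl
  from-to : ∀ X → _ → take (n G) X ++ [] ≡ X
  from-to X _ with split (n G) X
  ... | p ⊕ [] = ≡.cong (_++ []) (take-++ p [])
  to-from : ∀ X → _ → take (n G) (X ++ []) ≡ X
  to-from X _ = take-++ X []
  to-mono : ∀ X X′ → _ → _ → X ⊆ X′ → take (n G) X ⊆ take (n G) X′
  to-mono X X′ _ _ X⊆X′ with split (n G) X | split (n G) X′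
  ... | p ⊕ [] | p′ ⊕ [] = ≡.subst₂ _⊆_ (≡.sym (take-++ p [])) (≡.sym (take-++ p′ [])) (++-⊆⁻ˡ p p′ X⊆X′)
  from-mono : ∀ X X′ → _ → _ → X ⊆ X′ → X ++ [] ⊆ X′ ++ []
  from-mono _ _ _ _ X⊆X′ = ++-⊆⁺ X⊆X′ ⊆-refl

module _ {G : SetSystem} (cg : IsConvexGeometry G) where
  open IsConvexGeometry cg

  minor-⊥-Z-Iso : Iso (minor G ⊥ (Z G)) G
  minor-⊥-Z-Iso = sameClosedSets⇒Iso {E′ = E G} to-cl from-cl
    where
    to-cl : ∀ Y → Closed (minor G ⊥ (Z G)) Y → Closed G Y
    to-cl Y cY with minor-closed⁻ G ⊥ (Z G) cY
    ... | preimage W cW _ _ ≡.refl = ≡.subst (Closed G) (≡.sym (p─⊥≡p W)) cW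
    from-cl : ∀ Y → Closed G Y → Closed (minor G ⊥ (Z G)) Y
    from-cl Y cY = minor-closed⁺ G cY (⊆-min Y) (closed⊆Z Y cY) (p─⊥≡p Y)

  minor-Z-⊤-Iso : ∀ A → Iso (minor G A (Z G)) (minor G A ⊤)
  minor-Z-⊤-Iso A = sameClosedSets⇒Iso to-cl from-cl
    where
    to-cl : ∀ Y → Closed (minor G A (Z G)) Y → Closed (minor G A ⊤) Y
    to-cl Y cY with minor-closed⁻ G A (Z G) cY
    ... | preimage W cW A⊆W _ W─A≡Y = minor-closed⁺ G cW A⊆W (⊆-max W) W─A≡Y
    from-cl : ∀ Y → Closed (minor G A ⊤) Y → Closed (minor G A (Z G)) Y
    from-cl Y cY with minor-closed⁻ G A ⊤ cY
    ... | preimage W cW A⊆W _ W─A≡Y = minor-closed⁺ G cW A⊆W (closed⊆Z W cW) W─A≡Y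

minor-emptyGeometry-Iso : ∀ (A B : Subset 0) → Iso (minor emptyGeometry A B) emptyGeometry
minor-emptyGeometry-Iso [] [] = sameClosedSets⇒Iso (λ _ _ → ≡.refl) λ { [] _ → ≡.refl }

module _ {c ℓ} (K : Field c ℓ) where
  open Field K
  open Spaces K
  open import Relation.Binary.Reasoning.Setoid setoid
  open import Algebra.Properties.CommutativeSemigroup +-commutativeSemigroup using (interchange)
  open import Algebra.Properties.CommutativeSemigroup *-commutativeSemigroup using (x∙yz≈y∙xz)

  ∑ : ∀ {a} {A : Set a} → List A → (A → Carrier) → Carrier
  ∑ xs h = foldr (λ x s → h x + s) 0# xs

  infix 5 ∑
  syntax ∑ xs (λ x → e) = ∑[ x ∈ xs ] e

  -- ev₁, ev₂ and ev₃ unfold definitionally to eval, and _·_, _·²_, Δ, Δ⊗id and id⊗Δ to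
  -- instances of bind below, so the lemmas about eval and bind apply to them directly.
  eval : ∀ {a} {A : Set a} → (A → Carrier) → List (Carrier × A) → Carrier
  eval f xs = ∑[ p ∈ xs ] proj₁ p * f (proj₂ p)

  module _ {a} {A : Set a} where

    ∑-cong : ∀ (xs : List A) {h h′} → (∀ x → h x ≈ h′ x) → ∑ xs h ≈ ∑ xs h′
    ∑-cong []       _  = refl
    ∑-cong (x ∷ xs) h≈ = +-cong (h≈ x) (∑-cong xs h≈)

    ∑-++ : ∀ (xs ys : List A) h → ∑ (xs ++ₗ ys) h ≈ ∑ xs h + ∑ ys h
    ∑-++ []       ys h = sym (+-identityˡ _)
    ∑-++ (x ∷ xs) ys h = trans (+-congˡ (∑-++ xs ys h)) (sym (+-assoc _ _ _))

    ∑-map : ∀ {b} {B : Set b} (g : B → A) (xs : List B) h → ∑ (map g xs) h ≡ ∑ xs (h ∘ g)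
    ∑-map g []       h = ≡.refl
    ∑-map g (x ∷ xs) h = ≡.cong (h (g x) +_) (∑-map g xs h)

    ∑-concatMap : ∀ {b} {B : Set b} (g : B → List A) (xs : List B) h →
                  ∑ (concatMap g xs) h ≈ ∑[ x ∈ xs ] ∑ (g x) h
    ∑-concatMap g []       h = refl
    ∑-concatMap g (x ∷ xs) h = trans (∑-++ (g x) (concatMap g xs) h) (+-congˡ (∑-concatMap g xs h))

    *-distribˡ-∑ : ∀ k (xs : List A) h → k * ∑ xs h ≈ ∑[ x ∈ xs ] k * h x
    *-distribˡ-∑ k []       h = zeroʳ k
    *-distribˡ-∑ k (x ∷ xs) h = trans (distribˡ k _ _) (+-congˡ (*-distribˡ-∑ k xs h))

    ∑-+ : ∀ (xs : List A) h h′ → ∑[ x ∈ xs ] (h x + h′ x) ≈ ∑ xs h + ∑ xs h′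
    ∑-+ []       h h′ = sym (+-identityˡ _)
    ∑-+ (x ∷ xs) h h′ = trans (+-congˡ (∑-+ xs h h′)) (interchange (h x) (h′ x) (∑ xs h) (∑ xs h′))

    ∑-zero : ∀ (xs : List A) {h} → (∀ x → h x ≈ 0#) → ∑ xs h ≈ 0#
    ∑-zero []       _  = refl
    ∑-zero (x ∷ xs) h≈ = trans (+-cong (h≈ x) (∑-zero xs h≈)) (+-identityˡ _)

  ∑-comm : ∀ {a b} {A : Set a} {B : Set b} (xs : List A) (ys : List B) (h : A → B → Carrier) →
           ∑[ x ∈ xs ] ∑[ y ∈ ys ] h x y ≈ ∑[ y ∈ ys ] ∑[ x ∈ xs ] h x y
  ∑-comm []       ys h = sym (∑-zero ys (λ _ → refl))
  ∑-comm (x ∷ xs) ys h = trans (+-congˡ (∑-comm xs ys h)) (sym (∑-+ ys (h x) (λ y → ∑[ x′ ∈ xs ] h x′ y)))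

  when : Bool → Carrier → Carrier
  when b v = if b then v else 0#

  when-cong : ∀ b {v v′} → (b ≡ true → v ≈ v′) → when b v ≈ when b v′
  when-cong true  v≈v′ = v≈v′ ≡.refl
  when-cong false _    = refl

  when-∧ : ∀ b b′ v → when (b ∧ b′) v ≡ when b (when b′ v)
  when-∧ true  b′ v = ≡.refl
  when-∧ false b′ v = ≡.refl

  when-split : ∀ {b} b₁ b₂ v → b ≡ b₁ ∧ b₂ → when b v ≡ when b₁ (when b₂ v)
  when-split b₁ b₂ v ≡.refl = when-∧ b₁ b₂ v

  when-comm : ∀ b b′ v → when b (when b′ v) ≡ when b′ (when b v)
  when-comm true  b′    v = ≡.refl
  when-comm false true  v = ≡.refl
  when-comm false false v = ≡.refl

  when-∑ : ∀ {a} {A : Set a} b (xs : List A) h → when b (∑ xs h) ≈ ∑[ x ∈ xs ] when b (h x)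
  when-∑ true  xs h = refl
  when-∑ false xs h = sym (∑-zero xs (λ _ → refl))

  when-false : ∀ {b} v → b ≡ false → when b v ≈ 0#
  when-false v ≡.refl = refl

  ∑-when-none : ∀ {a} {A : Set a} (xs : List A) (d : A → Bool) (h : A → Carrier) →
                (∀ x → d x ≢ true) → ∑[ x ∈ xs ] when (d x) (h x) ≈ 0#
  ∑-when-none xs d h none = ∑-zero xs (λ x → when-false (h x) (¬-not (none x)))

  ∑-filterᵇ : ∀ {a} {A : Set a} (P : A → Bool) (xs : List A) h →
              ∑ (filterᵇ P xs) h ≈ ∑[ x ∈ xs ] when (P x) (h x)
  ∑-filterᵇ P []       h = refl
  ∑-filterᵇ P (x ∷ xs) h with P x
  ... | true  = +-congˡ (∑-filterᵇ P xs h)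
  ... | false = trans (∑-filterᵇ P xs h) (sym (+-identityˡ _))

  ∑-allSubsets-suc : ∀ n h → ∑ (allSubsets (suc n)) h ≈
                     (∑[ X ∈ allSubsets n ] h (outside ∷ X)) + (∑[ X ∈ allSubsets n ] h (inside ∷ X))
  ∑-allSubsets-suc n h = trans (∑-++ (map (outside ∷_) (allSubsets n)) _ h)
    (+-cong (reflexive (∑-map (outside ∷_) (allSubsets n) h)) (reflexive (∑-map (inside ∷_) (allSubsets n) h)))

  ∑-allSubsets-+ : ∀ k m (h : Subset (k +ℕ m) → Carrier) →
                   ∑ (allSubsets (k +ℕ m)) h ≈ ∑[ A ∈ allSubsets k ] ∑[ B ∈ allSubsets m ] h (A ++ B)
  ∑-allSubsets-+ zero    m h = sym (+-identityʳ _)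
  ∑-allSubsets-+ (suc k) m h = begin
    ∑ (allSubsets (suc k +ℕ m)) h
      ≈⟨ ∑-allSubsets-suc (k +ℕ m) h ⟩
    (∑[ X ∈ allSubsets (k +ℕ m) ] h (outside ∷ X)) + (∑[ X ∈ allSubsets (k +ℕ m) ] h (inside ∷ X))
      ≈⟨ +-cong (∑-allSubsets-+ k m (h ∘ (outside ∷_))) (∑-allSubsets-+ k m (h ∘ (inside ∷_))) ⟩
    (∑[ A ∈ allSubsets k ] ∑[ B ∈ allSubsets m ] h ((outside ∷ A) ++ B)) +
    (∑[ A ∈ allSubsets k ] ∑[ B ∈ allSubsets m ] h ((inside ∷ A) ++ B))
      ≈⟨ sym (∑-allSubsets-suc k (λ A → ∑[ B ∈ allSubsets m ] h (A ++ B))) ⟩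
    ∑[ A ∈ allSubsets (suc k) ] ∑[ B ∈ allSubsets m ] h (A ++ B) ∎

  ∑-δ : ∀ n (d : Subset n → Bool) {X₀} (h : Subset n → Carrier) → (∀ X → d X ≡ true → X ≡ X₀) → d X₀ ≡ true →
        ∑[ X ∈ allSubsets n ] when (d X) (h X) ≈ h X₀
  ∑-δ zero    d {[]}          h _      dX₀ rewrite dX₀ = +-identityʳ _
  ∑-δ (suc n) d {outside ∷ X₀} h unique dX₀ = trans (∑-allSubsets-suc n _)
    (trans (+-cong (∑-δ n (d ∘ (outside ∷_)) (h ∘ (outside ∷_)) (λ X e → ∷-injectiveʳ (unique _ e)) dX₀)
                   (∑-when-none (allSubsets n) _ (h ∘ (inside ∷_)) (λ X e → case ∷-injectiveˡ (unique _ e) of λ ())))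
           (+-identityʳ _))
  ∑-δ (suc n) d {inside ∷ X₀}  h unique dX₀ = trans (∑-allSubsets-suc n _)
    (trans (+-cong (∑-when-none (allSubsets n) _ (h ∘ (outside ∷_)) (λ X e → case ∷-injectiveˡ (unique _ e) of λ ()))
                   (∑-δ n (d ∘ (inside ∷_)) (h ∘ (inside ∷_)) (λ X e → ∷-injectiveʳ (unique _ e)) dX₀))
           (+-identityˡ _))

  ∑-reindex : ∀ {n m} (P : Subset n → Bool) (Q : Subset m → Bool)
              (φ : Subset n → Subset m) (ψ : Subset m → Subset n) (h : Subset m → Carrier) →
              (∀ X → P X ≡ true → Q (φ X) ≡ true) → (∀ Y → Q Y ≡ true → P (ψ Y) ≡ true) →
              (∀ X → P X ≡ true → ψ (φ X) ≡ X) → (∀ Y → Q Y ≡ true → φ (ψ Y) ≡ Y) →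
              ∑[ X ∈ allSubsets n ] when (P X) (h (φ X)) ≈ ∑[ Y ∈ allSubsets m ] when (Q Y) (h Y)
  ∑-reindex {n} {m} P Q φ ψ h P⇒Qφ Q⇒Pψ ψφ φψ = begin
    ∑[ X ∈ allSubsets n ] when (P X) (h (φ X))
      ≈⟨ ∑-cong (allSubsets n) (λ X → when-cong (P X) (λ _ → sym (∑-δ m (λ Y → ⌊ Y ≟ˢ φ X ⌋) h
                                       (λ Y → ⌊⌋-true⁻ (Y ≟ˢ φ X)) (⌊⌋-true⁺ (φ X ≟ˢ φ X) ≡.refl)))) ⟩
    ∑[ X ∈ allSubsets n ] when (P X) (∑[ Y ∈ allSubsets m ] when ⌊ Y ≟ˢ φ X ⌋ (h Y))
      ≈⟨ ∑-cong (allSubsets n) (λ X → when-∑ (P X) (allSubsets m) _) ⟩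
    ∑[ X ∈ allSubsets n ] ∑[ Y ∈ allSubsets m ] when (P X) (when ⌊ Y ≟ˢ φ X ⌋ (h Y))
      ≈⟨ ∑-comm (allSubsets n) (allSubsets m) _ ⟩
    ∑[ Y ∈ allSubsets m ] ∑[ X ∈ allSubsets n ] when (P X) (when ⌊ Y ≟ˢ φ X ⌋ (h Y))
      ≈⟨ ∑-cong (allSubsets m) fibre ⟩
    ∑[ Y ∈ allSubsets m ] when (Q Y) (h Y) ∎
    where
    fibre : ∀ Y → ∑[ X ∈ allSubsets n ] when (P X) (when ⌊ Y ≟ˢ φ X ⌋ (h Y)) ≈ when (Q Y) (h Y)
    fibre Y = trans (∑-cong (allSubsets n) (λ X → reflexive (≡.sym (when-∧ (P X) _ _)))) fibre′
      where
      in-fibre : ∀ X → P X ∧ ⌊ Y ≟ˢ φ X ⌋ ≡ true → P X ≡ true × Y ≡ φ X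
      in-fibre X e = let PX , Y≡φX = ∧-elim e in PX , ⌊⌋-true⁻ (Y ≟ˢ φ X) Y≡φX
      fibre′ : ∑[ X ∈ allSubsets n ] when (P X ∧ ⌊ Y ≟ˢ φ X ⌋) (h Y) ≈ when (Q Y) (h Y)
      fibre′ with Q Y in QY
      ... | true  = ∑-δ n _ (λ _ → h Y)
          (λ X e → let PX , Y≡φX = in-fibre X e in ≡.trans (≡.sym (ψφ X PX)) (≡.cong ψ (≡.sym Y≡φX)))
          (∧-intro (Q⇒Pψ Y QY) (⌊⌋-true⁺ (Y ≟ˢ φ (ψ Y)) (≡.sym (φψ Y QY))))
      ... | false = ∑-when-none (allSubsets n) _ (λ _ → h Y) λ X e →
          let PX , Y≡φX = in-fibre X e in
          case ≡.trans (≡.sym QY) (≡.subst (λ Z → Q Z ≡ true) (≡.sym Y≡φX) (P⇒Qφ X PX)) of λ ()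

  module _ {a} {A : Set a} where

    eval-cong : ∀ {f f′ : A → Carrier} xs → (∀ x → f x ≈ f′ x) → eval f xs ≈ eval f′ xs
    eval-cong xs f≈f′ = ∑-cong xs (λ p → *-congˡ (f≈f′ (proj₂ p)))

    eval-congᴬ : ∀ {p} {P : A → Set p} {f f′ : A → Carrier} {xs} → All (P ∘ proj₂) xs →
                 (∀ x → P x → f x ≈ f′ x) → eval f xs ≈ eval f′ xs
    eval-congᴬ []         _    = refl
    eval-congᴬ (px ∷ pxs) f≈f′ = +-cong (*-congˡ (f≈f′ _ px)) (eval-congᴬ pxs f≈f′)

    eval-*ˡ : ∀ k (f : A → Carrier) xs → eval (λ x → k * f x) xs ≈ k * eval f xs
    eval-*ˡ k f xs = trans (∑-cong xs (λ p → x∙yz≈y∙xz (proj₁ p) k (f (proj₂ p)))) (sym (*-distribˡ-∑ k xs _))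

    eval-*ʳ : ∀ k (f : A → Carrier) xs → eval (λ x → f x * k) xs ≈ eval f xs * k
    eval-*ʳ k f xs = trans (eval-cong xs (λ _ → *-comm _ _)) (trans (eval-*ˡ k f xs) (*-comm _ _))

    eval-singleton : ∀ (f : A → Carrier) x → eval f ((1# , x) ∷ []) ≈ f x
    eval-singleton f x = trans (+-identityʳ _) (*-identityˡ _)

    eval-rescale : ∀ {b} {B : Set b} (w : A → Carrier) (φ : A → B) (f : B → Carrier) xs →
                   eval f (map (λ p → (proj₁ p * w (proj₂ p) , φ (proj₂ p))) xs) ≈ eval (λ x → w x * f (φ x)) xs
    eval-rescale w φ f xs = trans (reflexive (∑-map _ xs _)) (∑-cong xs (λ _ → *-assoc _ _ _))

  eval-scale : ∀ {a b} {A : Set a} {B : Set b} k (φ : A → B) (f : B → Carrier) xs →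
               eval f (map (λ q → (k * proj₁ q , φ (proj₂ q))) xs) ≈ k * eval (f ∘ φ) xs
  eval-scale k φ f xs =
    trans (reflexive (∑-map _ xs _)) (trans (∑-cong xs (λ _ → *-assoc _ _ _)) (sym (*-distribˡ-∑ k xs _)))

  bind : ∀ {a b d} {A : Set a} {B : Set b} {C : Set d} → (A → B → C) → (A → List (Carrier × B)) →
         List (Carrier × A) → List (Carrier × C)
  bind ψ L = concatMap (λ p → map (λ q → (proj₁ p * proj₁ q , ψ (proj₂ p) (proj₂ q))) (L (proj₂ p)))

  eval-bind : ∀ {a b d} {A : Set a} {B : Set b} {C : Set d} (ψ : A → B → C) (L : A → List (Carrier × B))
              (f : C → Carrier) xs → eval f (bind ψ L xs) ≈ eval (λ x → eval (f ∘ ψ x) (L x)) xs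
  eval-bind ψ L f xs = begin
    eval f (bind ψ L xs)
      ≈⟨ ∑-concatMap _ xs _ ⟩
    ∑[ p ∈ xs ] eval f (map (λ q → (proj₁ p * proj₁ q , ψ (proj₂ p) (proj₂ q))) (L (proj₂ p)))
      ≈⟨ ∑-cong xs (λ p → eval-scale (proj₁ p) (ψ (proj₂ p)) f (L (proj₂ p))) ⟩
    eval (λ x → eval (f ∘ ψ x) (L x)) xs ∎

  eval-comm : ∀ {a b} {A : Set a} {B : Set b} (F : A → B → Carrier) xs ys →
              eval (λ x → eval (F x) ys) xs ≈ eval (λ y → eval (λ x → F x y) xs) ys
  eval-comm F xs ys = begin
    ∑[ p ∈ xs ] proj₁ p * (∑[ q ∈ ys ] proj₁ q * F (proj₂ p) (proj₂ q))
      ≈⟨ ∑-cong xs (λ p → *-distribˡ-∑ _ ys _) ⟩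
    ∑[ p ∈ xs ] ∑[ q ∈ ys ] proj₁ p * (proj₁ q * F (proj₂ p) (proj₂ q))
      ≈⟨ ∑-comm xs ys _ ⟩
    ∑[ q ∈ ys ] ∑[ p ∈ xs ] proj₁ p * (proj₁ q * F (proj₂ p) (proj₂ q))
      ≈⟨ ∑-cong ys (λ q → trans (∑-cong xs (λ p → x∙yz≈y∙xz _ _ _)) (sym (*-distribˡ-∑ _ xs _))) ⟩
    ∑[ q ∈ ys ] proj₁ q * (∑[ p ∈ xs ] proj₁ p * F (proj₂ p) (proj₂ q)) ∎


  -- The product

  ev-· : ∀ f a b → ev₁ f (a · b) ≈ ev₁ (λ G → ev₁ (λ H → f (product G H)) b) a
  ev-· f a b = eval-bind product (λ _ → b) f a

  ev-comm : ∀ (F : SetSystem → SetSystem → Carrier) a b →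
            ev₁ (λ G → ev₁ (F G) b) a ≈ ev₁ (λ H → ev₁ (λ G → F G H) a) b
  ev-comm = eval-comm

  ·-cong : ∀ {a a′ b b′} → a ≈₁ a′ → b ≈₁ b′ → (a · b) ≈₁ (a′ · b′)
  ·-cong {a} {a′} {b} {b′} a≈a′ b≈b′ f f-inv = begin
    ev₁ f (a · b)
      ≈⟨ ev-· f a b ⟩
    ev₁ (λ G → ev₁ (f ∘ product G) b) a
      ≈⟨ a≈a′ _ (λ G G′ i → eval-cong b (λ H → f-inv _ _ (product-Iso i (Iso-refl H)))) ⟩
    ev₁ (λ G → ev₁ (f ∘ product G) b) a′
      ≈⟨ ev-comm (λ G H → f (product G H)) a′ b ⟩
    ev₁ (λ H → ev₁ (λ G → f (product G H)) a′) b
      ≈⟨ b≈b′ _ (λ H H′ j → eval-cong a′ (λ G → f-inv _ _ (product-Iso (Iso-refl G) j))) ⟩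
    ev₁ (λ H → ev₁ (λ G → f (product G H)) a′) b′
      ≈⟨ ev-comm (λ G H → f (product G H)) a′ b′ ⟨
    ev₁ (λ G → ev₁ (f ∘ product G) b′) a′
      ≈⟨ ev-· f a′ b′ ⟨
    ev₁ f (a′ · b′) ∎

  ·-assoc : ∀ a b d → ((a · b) · d) ≈₁ (a · (b · d))
  ·-assoc a b d f f-inv = begin
    ev₁ f ((a · b) · d)
      ≈⟨ ev-· f (a · b) d ⟩
    ev₁ (λ X → ev₁ (f ∘ product X) d) (a · b)
      ≈⟨ ev-· _ a b ⟩
    ev₁ (λ G → ev₁ (λ H → ev₁ (λ I → f (product (product G H) I)) d) b) a
      ≈⟨ eval-cong a (λ G → eval-cong b (λ H → eval-cong d (λ I → f-inv _ _ (product-assoc-Iso G H I)))) ⟩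
    ev₁ (λ G → ev₁ (λ H → ev₁ (λ I → f (product G (product H I))) d) b) a
      ≈⟨ eval-cong a (λ G → ev-· (f ∘ product G) b d) ⟨
    ev₁ (λ G → ev₁ (f ∘ product G) (b · d)) a
      ≈⟨ ev-· f a (b · d) ⟨
    ev₁ f (a · (b · d)) ∎

  ·-identityˡ : ∀ a → (one · a) ≈₁ a
  ·-identityˡ a f f-inv = begin
    ev₁ f (one · a)                               ≈⟨ ev-· f one a ⟩
    ev₁ (λ G → ev₁ (f ∘ product G) a) one
      ≈⟨ eval-singleton (λ G → ev₁ (f ∘ product G) a) emptyGeometry ⟩
    ev₁ (f ∘ product emptyGeometry) a             ≈⟨ eval-cong a (λ H → f-inv _ _ (product-identityˡ-Iso H)) ⟩
    ev₁ f a                                       ∎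

  ·-identityʳ : ∀ a → (a · one) ≈₁ a
  ·-identityʳ a f f-inv = begin
    ev₁ f (a · one)                               ≈⟨ ev-· f a one ⟩
    ev₁ (λ G → ev₁ (f ∘ product G) one) a
      ≈⟨ eval-cong a (λ G → eval-singleton (f ∘ product G) emptyGeometry) ⟩
    ev₁ (λ G → f (product G emptyGeometry)) a     ≈⟨ eval-cong a (λ G → f-inv _ _ (product-identityʳ-Iso G)) ⟩
    ev₁ f a                                       ∎

  -- The counit

  εbasis-when : ∀ G → εbasis G ≡ when (isEmptyGround G) 1#
  εbasis-when G with isEmptyGround G
  ... | true  = ≡.refl
  ... | false = ≡.refl

  isEmptyGround-product : ∀ G H → isEmptyGround (product G H) ≡ isEmptyGround G ∧ isEmptyGround H
  isEmptyGround-product G H with Z G ≟ˢ ⊥ | Z H ≟ˢ ⊥ | (Z G ++ Z H) ≟ˢ ⊥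
  ... | yes _    | yes _    | yes _     = ≡.refl
  ... | yes ZG≡⊥ | yes ZH≡⊥ | no  Z≢⊥   = ⊥-elim (Z≢⊥ (≡.trans (≡.cong₂ _++_ ZG≡⊥ ZH≡⊥) (≡.sym (⊥-++ (n G)))))
  ... | yes _    | no  ZH≢⊥ | yes Z≡⊥   = ⊥-elim (ZH≢⊥ (++-injectiveʳ (Z G) ⊥ (≡.trans Z≡⊥ (⊥-++ (n G)))))
  ... | yes _    | no  _    | no  _     = ≡.refl
  ... | no  ZG≢⊥ | _        | yes Z≡⊥   = ⊥-elim (ZG≢⊥ (++-injectiveˡ (Z G) ⊥ (≡.trans Z≡⊥ (⊥-++ (n G)))))
  ... | no  _    | _        | no  _     = ≡.refl

  εbasis-product : ∀ G H → εbasis (product G H) ≈ εbasis G * εbasis H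
  εbasis-product G H
    rewrite εbasis-when (product G H) | εbasis-when G | εbasis-when H | isEmptyGround-product G H
    with isEmptyGround G
  ... | true  = sym (*-identityˡ _)
  ... | false = sym (zeroˡ _)

  ε-homo : ∀ a b → ε (a · b) ≈ ε a * ε b
  ε-homo a b = begin
    ev₁ εbasis (a · b)                                 ≈⟨ ev-· εbasis a b ⟩
    ev₁ (λ G → ev₁ (λ H → εbasis (product G H)) b) a   ≈⟨ eval-cong a (λ G → eval-cong b (εbasis-product G)) ⟩
    ev₁ (λ G → ev₁ (λ H → εbasis G * εbasis H) b) a    ≈⟨ eval-cong a (λ G → eval-*ˡ (εbasis G) εbasis b) ⟩
    ev₁ (λ G → εbasis G * ε b) a                       ≈⟨ eval-*ʳ (ε b) εbasis a ⟩
    ε a * ε b                                          ∎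

  ε-one : ε one ≈ 1#
  ε-one = eval-singleton εbasis emptyGeometry

  -- εbasis is not isomorphism invariant on arbitrary set systems, but on convex geometries
  -- Z = ∅ says exactly that the lattice of closed sets is trivial, which is invariant.
  TwoClosedSets : SetSystem → Set
  TwoClosedSets G = ∃ λ X → ∃ λ Y → Closed G X × Closed G Y × X ≢ Y

  twoClosedSets? : ∀ G → Dec (TwoClosedSets G)
  twoClosedSets? G = anySubset? λ X → anySubset? λ Y →
    (E G X ≟ᵇ true) ×-dec ((E G Y ≟ᵇ true) ×-dec ¬? (X ≟ˢ Y))

  Iso-TwoClosedSets : ∀ {G H} → Iso G H → TwoClosedSets H → TwoClosedSets G
  Iso-TwoClosedSets i (X , Y , cX , cY , X≢Y) =
    from X , from Y , from-cl X cX , from-cl Y cY ,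
    λ fX≡fY → X≢Y (≡.trans (≡.sym (to-from X cX)) (≡.trans (≡.cong to fX≡fY) (to-from Y cY)))
    where open Iso i

  εᵢ : SetSystem → Carrier
  εᵢ G = if does (twoClosedSets? G) then 0# else 1#

  εᵢ-invariant : Invariant₁ εᵢ
  εᵢ-invariant G H i with twoClosedSets? G | twoClosedSets? H
  ... | yes _  | yes _  = refl
  ... | no  _  | no  _  = refl
  ... | yes tG | no ¬tH = ⊥-elim (¬tH (Iso-TwoClosedSets (Iso-sym i) tG))
  ... | no ¬tG | yes tH = ⊥-elim (¬tG (Iso-TwoClosedSets i tH))

  module _ {G} (cg : IsConvexGeometry G) where
    open IsConvexGeometry cg

    εbasis≈εᵢ : εbasis G ≈ εᵢ G
    εbasis≈εᵢ rewrite εbasis-when G with Z G ≟ˢ ⊥ | twoClosedSets? G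
    ... | yes _    | no  _ = refl
    ... | no  _    | yes _ = refl
    ... | yes Z≡⊥  | yes (X , Y , cX , cY , X≢Y) = ⊥-elim (X≢Y (≡.trans (≡⊥ X cX) (≡.sym (≡⊥ Y cY))))
      where
      ≡⊥ : ∀ W → Closed G W → W ≡ ⊥
      ≡⊥ W cW = ⊆-antisym (≡.subst (W ⊆_) Z≡⊥ (closed⊆Z W cW)) (⊆-min W)
    ... | no  Z≢⊥  | no ¬two = ⊥-elim (¬two (Z G , ⊥ , Z-closed , ∅-closed , Z≢⊥))

  ε-cong : ∀ {a a′} → AllCG a → AllCG a′ → a ≈₁ a′ → ε a ≈ ε a′
  ε-cong {a} {a′} cg-a cg-a′ a≈a′ = begin
    ev₁ εbasis a   ≈⟨ eval-congᴬ cg-a (λ _ → εbasis≈εᵢ) ⟩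
    ev₁ εᵢ a       ≈⟨ a≈a′ εᵢ εᵢ-invariant ⟩
    ev₁ εᵢ a′      ≈⟨ eval-congᴬ cg-a′ (λ _ → εbasis≈εᵢ) ⟨
    ev₁ εbasis a′  ∎

  -- The coproduct

  Δcoeff : (SetSystem → SetSystem → Carrier) → SetSystem → Carrier
  Δcoeff g G = ∑[ X ∈ allSubsets (n G) ] when (E G X) (g (minor G ⊥ X) (minor G X (Z G)))

  Δcoeff-cong : ∀ {g g′} G → (∀ G₁ G₂ → g G₁ G₂ ≈ g′ G₁ G₂) → Δcoeff g G ≈ Δcoeff g′ G
  Δcoeff-cong G g≈g′ = ∑-cong (allSubsets (n G)) (λ X → when-cong (E G X) (λ _ → g≈g′ _ _))

  ev-Δbasis : ∀ g G → ev₂ g (Δbasis G) ≈ Δcoeff g G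
  ev-Δbasis g G = begin
    ev₂ g (Δbasis G)
      ≡⟨ ∑-map _ (closedSets G) _ ⟩
    ∑[ X ∈ closedSets G ] 1# * g (minor G ⊥ X) (minor G X (Z G))
      ≈⟨ ∑-filterᵇ (E G) (allSubsets (n G)) _ ⟩
    ∑[ X ∈ allSubsets (n G) ] when (E G X) (1# * g (minor G ⊥ X) (minor G X (Z G)))
      ≈⟨ ∑-cong (allSubsets (n G)) (λ X → when-cong (E G X) (λ _ → *-identityˡ _)) ⟩
    Δcoeff g G ∎

  ev-Δ : ∀ g a → ev₂ g (Δ a) ≈ ev₁ (Δcoeff g) a
  ev-Δ g a = trans (eval-bind (λ _ GH → GH) Δbasis (uncurry g) a) (eval-cong a (ev-Δbasis g))

  -- Δcoeff g is isomorphism invariant only on convex geometries, whose closed sets lie in the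
  -- ground set; replacing Z by ⊤ gives an invariant function that agrees with it there.
  Δcoeffᵢ : (SetSystem → SetSystem → Carrier) → SetSystem → Carrier
  Δcoeffᵢ g G = ∑[ X ∈ allSubsets (n G) ] when (E G X) (g (minor G ⊥ X) (minor G X ⊤))

  Δcoeff≈Δcoeffᵢ : ∀ {g} → Invariant₂ g → ∀ G → IsConvexGeometry G → Δcoeff g G ≈ Δcoeffᵢ g G
  Δcoeff≈Δcoeffᵢ g-inv G cg = ∑-cong (allSubsets (n G)) (λ X → when-cong (E G X) (λ _ →
    g-inv _ _ _ _ (Iso-refl (minor G ⊥ X)) (minor-Z-⊤-Iso cg X)))

  Δcoeffᵢ-invariant : ∀ {g} → Invariant₂ g → Invariant₁ (Δcoeffᵢ g)
  Δcoeffᵢ-invariant {g} g-inv G G′ i = begin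
    Δcoeffᵢ g G
      ≈⟨ ∑-cong (allSubsets (n G)) (λ X → when-cong (E G X) (λ cX → g-inv _ _ _ _ (below X cX) (above X cX))) ⟩
    ∑[ X ∈ allSubsets (n G) ] when (E G X) (h (to X))
      ≈⟨ ∑-reindex (E G) (E G′) to from h to-cl from-cl from-to to-from ⟩
    Δcoeffᵢ g G′ ∎
    where
    open Iso i
    h : Subset (n G′) → Carrier
    h Y = g (minor G′ ⊥ Y) (minor G′ Y ⊤)
    from-⊆ : ∀ X W′ → Closed G X → Closed G′ W′ → W′ ⊆ to X → from W′ ⊆ X
    from-⊆ X W′ cX cW′ W′⊆tX = ≡.subst (_ ⊆_) (from-to X cX) (Iso-from-mono i W′ (to X) cW′ (to-cl X cX) W′⊆tX)
    ⊆-from : ∀ X W′ → Closed G X → Closed G′ W′ → to X ⊆ W′ → X ⊆ from W′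
    ⊆-from X W′ cX cW′ tX⊆W′ = ≡.subst (_⊆ _) (from-to X cX) (Iso-from-mono i (to X) W′ (to-cl X cX) cW′ tX⊆W′)
    below : ∀ X → Closed G X → Iso (minor G ⊥ X) (minor G′ ⊥ (to X))
    below X cX = minor-Iso i (λ W cW _ W⊆X → ⊆-min _ , Equivalence.to (order W X cW cX) W⊆X)
                             (λ W′ cW′ _ W′⊆tX → ⊆-min _ , from-⊆ X W′ cX cW′ W′⊆tX)
    above : ∀ X → Closed G X → Iso (minor G X ⊤) (minor G′ (to X) ⊤)
    above X cX = minor-Iso i (λ W cW X⊆W _ → Equivalence.to (order X W cX cW) X⊆W , ⊆-max _)
                             (λ W′ cW′ tX⊆W′ _ → ⊆-from X W′ cX cW′ tX⊆W′ , ⊆-max _)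

  Δ-cong : ∀ {a a′} → AllCG a → AllCG a′ → a ≈₁ a′ → Δ a ≈₂ Δ a′
  Δ-cong {a} {a′} cg-a cg-a′ a≈a′ g g-inv = begin
    ev₂ g (Δ a)           ≈⟨ ev-Δ g a ⟩
    ev₁ (Δcoeff g) a      ≈⟨ eval-congᴬ cg-a (Δcoeff≈Δcoeffᵢ g-inv) ⟩
    ev₁ (Δcoeffᵢ g) a     ≈⟨ a≈a′ (Δcoeffᵢ g) (Δcoeffᵢ-invariant g-inv) ⟩
    ev₁ (Δcoeffᵢ g) a′    ≈⟨ eval-congᴬ cg-a′ (Δcoeff≈Δcoeffᵢ g-inv) ⟨
    ev₁ (Δcoeff g) a′     ≈⟨ ev-Δ g a′ ⟨
    ev₂ g (Δ a′)          ∎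

  εbasis-* : ∀ G v → εbasis G * v ≈ when (isEmptyGround G) v
  εbasis-* G v rewrite εbasis-when G with isEmptyGround G
  ... | true  = *-identityˡ v
  ... | false = zeroˡ v

  ∑-closed-δ : ∀ G (d : Subset (n G) → Bool) {X₀} (h : Subset (n G) → Carrier) →
               (∀ X → Closed G X → d X ≡ true → X ≡ X₀) → Closed G X₀ → d X₀ ≡ true →
               ∑[ X ∈ allSubsets (n G) ] when (E G X) (when (d X) (h X)) ≈ h X₀
  ∑-closed-δ G d h unique cX₀ dX₀ =
    trans (∑-cong (allSubsets (n G)) (λ X → reflexive (≡.sym (when-∧ (E G X) (d X) _))))
          (∑-δ (n G) _ h (λ X e → let cX , dX = ∧-elim e in unique X cX dX) (∧-intro cX₀ dX₀))

  Δcoeff-εˡ : ∀ {f} → Invariant₁ f → ∀ G → IsConvexGeometry G → Δcoeff (λ G₁ G₂ → εbasis G₁ * f G₂) G ≈ f G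
  Δcoeff-εˡ {f} f-inv G cg = begin
    Δcoeff (λ G₁ G₂ → εbasis G₁ * f G₂) G
      ≈⟨ Δcoeff-cong G (λ G₁ G₂ → εbasis-* G₁ (f G₂)) ⟩
    ∑[ X ∈ allSubsets (n G) ] when (E G X) (when ⌊ (X ─ ⊥) ≟ˢ ⊥ ⌋ (f (minor G X (Z G))))
      ≈⟨ ∑-closed-δ G _ (λ X → f (minor G X (Z G)))
           (λ X _ e → ≡.trans (≡.sym (p─⊥≡p X)) (⌊⌋-true⁻ ((X ─ ⊥) ≟ˢ ⊥) e))
           ∅-closed (⌊⌋-true⁺ ((⊥ ─ ⊥) ≟ˢ ⊥) (p─⊥≡p ⊥)) ⟩
    f (minor G ⊥ (Z G))
      ≈⟨ f-inv _ _ (minor-⊥-Z-Iso cg) ⟩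
    f G ∎
    where open IsConvexGeometry cg

  Δcoeff-εʳ : ∀ {f} → Invariant₁ f → ∀ G → IsConvexGeometry G → Δcoeff (λ G₁ G₂ → εbasis G₂ * f G₁) G ≈ f G
  Δcoeff-εʳ {f} f-inv G cg = begin
    Δcoeff (λ G₁ G₂ → εbasis G₂ * f G₁) G
      ≈⟨ Δcoeff-cong G (λ G₁ G₂ → εbasis-* G₂ (f G₁)) ⟩
    ∑[ X ∈ allSubsets (n G) ] when (E G X) (when ⌊ (Z G ─ X) ≟ˢ ⊥ ⌋ (f (minor G ⊥ X)))
      ≈⟨ ∑-closed-δ G _ (λ X → f (minor G ⊥ X))
           (λ X cX e → ⊆-antisym (closed⊆Z X cX) (p─q≡⊥⇒p⊆q (⌊⌋-true⁻ ((Z G ─ X) ≟ˢ ⊥) e)))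
           Z-closed (⌊⌋-true⁺ ((Z G ─ Z G) ≟ˢ ⊥) (p─p≡⊥ (Z G))) ⟩
    f (minor G ⊥ (Z G))
      ≈⟨ f-inv _ _ (minor-⊥-Z-Iso cg) ⟩
    f G ∎
    where open IsConvexGeometry cg

  ε-counitˡ : ∀ {a} → AllCG a → ε⊗id (Δ a) ≈₁ a
  ε-counitˡ {a} cg-a f f-inv = begin
    ev₁ f (ε⊗id (Δ a))                                   ≈⟨ eval-rescale (εbasis ∘ proj₁) proj₂ f (Δ a) ⟩
    ev₂ (λ G₁ G₂ → εbasis G₁ * f G₂) (Δ a)               ≈⟨ ev-Δ _ a ⟩
    ev₁ (Δcoeff (λ G₁ G₂ → εbasis G₁ * f G₂)) a          ≈⟨ eval-congᴬ cg-a (Δcoeff-εˡ f-inv) ⟩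
    ev₁ f a                                              ∎

  ε-counitʳ : ∀ {a} → AllCG a → id⊗ε (Δ a) ≈₁ a
  ε-counitʳ {a} cg-a f f-inv = begin
    ev₁ f (id⊗ε (Δ a))                                   ≈⟨ eval-rescale (εbasis ∘ proj₂) proj₁ f (Δ a) ⟩
    ev₂ (λ G₁ G₂ → εbasis G₂ * f G₁) (Δ a)               ≈⟨ ev-Δ _ a ⟩
    ev₁ (Δcoeff (λ G₁ G₂ → εbasis G₂ * f G₁)) a          ≈⟨ eval-congᴬ cg-a (Δcoeff-εʳ f-inv) ⟩
    ev₁ f a                                              ∎

  Δ-one : Δ one ≈₂ one²
  Δ-one g g-inv = begin
    ev₂ g (Δ one)                                            ≈⟨ ev-Δ g one ⟩
    ev₁ (Δcoeff g) one                                       ≈⟨ eval-singleton (Δcoeff g) emptyGeometry ⟩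
    g (minor emptyGeometry ⊥ []) (minor emptyGeometry [] []) + 0#   ≈⟨ +-identityʳ _ ⟩
    g (minor emptyGeometry ⊥ []) (minor emptyGeometry [] [])
      ≈⟨ g-inv _ _ _ _ (minor-emptyGeometry-Iso ⊥ []) (minor-emptyGeometry-Iso [] []) ⟩
    g emptyGeometry emptyGeometry
      ≈⟨ eval-singleton (uncurry g) (emptyGeometry , emptyGeometry) ⟨
    ev₂ g one²                                               ∎

  -- The coproduct is multiplicative

  E-product : ∀ G H (A : Subset (n G)) (B : Subset (n H)) → E (product G H) (A ++ B) ≡ E G A ∧ E H B
  E-product G H A B rewrite take-++ A B | drop-++ A B = ≡.refl

  product² : (SetSystem → SetSystem → Carrier) → SetSystem → SetSystem → SetSystem → SetSystem → Carrier
  product² g G₁ G₂ H₁ H₂ = g (product G₁ H₁) (product G₂ H₂)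

  Δcoeff-product : ∀ {g} → Invariant₂ g → ∀ G H →
                   Δcoeff g (product G H) ≈ Δcoeff (λ G₁ G₂ → Δcoeff (product² g G₁ G₂) H) G
  Δcoeff-product {g} g-inv G H = begin
    Δcoeff g (product G H)
      ≈⟨ ∑-allSubsets-+ (n G) (n H) _ ⟩
    ∑[ A ∈ allSubsets (n G) ] ∑[ B ∈ allSubsets (n H) ] when (E (product G H) (A ++ B)) (term A B)
      ≈⟨ ∑-cong (allSubsets (n G)) (λ A → ∑-cong (allSubsets (n H)) (λ B → split-term A B)) ⟩
    ∑[ A ∈ allSubsets (n G) ] ∑[ B ∈ allSubsets (n H) ] when (E G A) (when (E H B) (term² A B))
      ≈⟨ ∑-cong (allSubsets (n G)) (λ A → when-∑ (E G A) (allSubsets (n H)) _) ⟨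
    Δcoeff (λ G₁ G₂ → Δcoeff (product² g G₁ G₂) H) G ∎
    where
    term : Subset (n G) → Subset (n H) → Carrier
    term A B = g (minor (product G H) ⊥ (A ++ B)) (minor (product G H) (A ++ B) (Z G ++ Z H))
    term² : Subset (n G) → Subset (n H) → Carrier
    term² A B = product² g (minor G ⊥ A) (minor G A (Z G)) (minor H ⊥ B) (minor H B (Z H))
    minor-product-⊥-Iso : ∀ A B → Iso (minor (product G H) ⊥ (A ++ B)) (product (minor G ⊥ A) (minor H ⊥ B))
    minor-product-⊥-Iso A B =
      ≡.subst (λ U → Iso (minor (product G H) U (A ++ B)) (product (minor G ⊥ A) (minor H ⊥ B)))
              (≡.sym (⊥-++ (n G))) (minor-product-Iso G H ⊥ A ⊥ B)
    split-term : ∀ A B → when (E (product G H) (A ++ B)) (term A B) ≈ when (E G A) (when (E H B) (term² A B))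
    split-term A B = trans (reflexive (when-split (E G A) (E H B) _ (E-product G H A B)))
      (when-cong (E G A) (λ _ → when-cong (E H B) (λ _ →
        g-inv _ _ _ _ (minor-product-⊥-Iso A B) (minor-product-Iso G H A (Z G) B (Z H)))))

  Δcoeff-ev-comm : ∀ (F : SetSystem → SetSystem → SetSystem → Carrier) b G →
                   Δcoeff (λ G₁ G₂ → ev₁ (F G₁ G₂) b) G ≈ ev₁ (λ H → Δcoeff (λ G₁ G₂ → F G₁ G₂ H) G) b
  Δcoeff-ev-comm F b G = begin
    Δcoeff (λ G₁ G₂ → ev₁ (F G₁ G₂) b) G                 ≈⟨ ev-Δbasis _ G ⟨
    ev₂ (λ G₁ G₂ → ev₁ (F G₁ G₂) b) (Δbasis G)           ≈⟨ eval-comm (uncurry F) (Δbasis G) b ⟩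
    ev₁ (λ H → ev₂ (λ G₁ G₂ → F G₁ G₂ H) (Δbasis G)) b   ≈⟨ eval-cong b (λ H → ev-Δbasis _ G) ⟩
    ev₁ (λ H → Δcoeff (λ G₁ G₂ → F G₁ G₂ H) G) b         ∎

  ev-·² : ∀ g x y → ev₂ g (x ·² y) ≈ ev₂ (λ G₁ G₂ → ev₂ (product² g G₁ G₂) y) x
  ev-·² g x y = eval-bind (λ G H → product (proj₁ G) (proj₁ H) , product (proj₂ G) (proj₂ H))
                          (λ _ → y) (uncurry g) x

  Δ-homo : ∀ a b → Δ (a · b) ≈₂ (Δ a ·² Δ b)
  Δ-homo a b g g-inv = begin
    ev₂ g (Δ (a · b))                                                  ≈⟨ ev-Δ g (a · b) ⟩
    ev₁ (Δcoeff g) (a · b)                                             ≈⟨ ev-· (Δcoeff g) a b ⟩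
    ev₁ (λ G → ev₁ (Δcoeff g ∘ product G) b) a
      ≈⟨ eval-cong a (λ G → eval-cong b (Δcoeff-product g-inv G)) ⟩
    ev₁ (λ G → ev₁ (λ H → Δcoeff (λ G₁ G₂ → Δcoeff (product² g G₁ G₂) H) G) b) a
      ≈⟨ eval-cong a (λ G → Δcoeff-ev-comm (λ G₁ G₂ → Δcoeff (product² g G₁ G₂)) b G) ⟨
    ev₁ (Δcoeff (λ G₁ G₂ → ev₁ (Δcoeff (product² g G₁ G₂)) b)) a
      ≈⟨ eval-cong a (λ G → Δcoeff-cong G (λ G₁ G₂ → ev-Δ (product² g G₁ G₂) b)) ⟨
    ev₁ (Δcoeff (λ G₁ G₂ → ev₂ (product² g G₁ G₂) (Δ b))) a            ≈⟨ ev-Δ _ a ⟨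
    ev₂ (λ G₁ G₂ → ev₂ (product² g G₁ G₂) (Δ b)) (Δ a)                 ≈⟨ ev-·² g (Δ a) (Δ b) ⟨
    ev₂ g (Δ a ·² Δ b)                                                 ∎

  -- Coassociativity

  ev-Δ⊗id : ∀ g x → ev₃ g (Δ⊗id x) ≈ ev₂ (λ G H → Δcoeff (λ G₁ G₂ → g G₁ G₂ H) G) x
  ev-Δ⊗id g x = trans (eval-bind (λ GH G₁G₂ → proj₁ G₁G₂ , proj₂ G₁G₂ , proj₂ GH) (Δbasis ∘ proj₁) _ x)
                      (eval-cong x (λ GH → ev-Δbasis _ (proj₁ GH)))

  ev-id⊗Δ : ∀ g x → ev₃ g (id⊗Δ x) ≈ ev₂ (λ G H → Δcoeff (λ H₁ H₂ → g G H₁ H₂) H) x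
  ev-id⊗Δ g x = trans (eval-bind (λ GH H₁H₂ → proj₁ GH , proj₁ H₁H₂ , proj₂ H₁H₂) (Δbasis ∘ proj₂) _ x)
                      (eval-cong x (λ GH → ev-Δbasis _ (proj₂ GH)))

  E-minor-⊥ : ∀ G X Y → E (minor G ⊥ X) Y ≡ E G Y ∧ ⌊ Y ⊆? X ⌋
  E-minor-⊥ G X Y = ≡true-ext
    (λ cY → case minor-closed⁻ G ⊥ X cY of λ { (preimage W cW _ W⊆X ≡.refl) →
       ≡.subst (λ V → E G V ∧ ⌊ V ⊆? X ⌋ ≡ true) (≡.sym (p─⊥≡p W)) (∧-intro cW (⌊⌋-true⁺ (W ⊆? X) W⊆X)) })
    (λ e → let cY , Y⊆X = ∧-elim e in minor-closed⁺ G cY (⊆-min Y) (⌊⌋-true⁻ (Y ⊆? X) Y⊆X) (p─⊥≡p Y))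

  module _ {g} (g-inv : Invariant₃ g) {G} (cg : IsConvexGeometry G) where
    open IsConvexGeometry cg

    private
      chain : Subset (n G) → Subset (n G) → Carrier
      chain Y X = g (minor G ⊥ Y) (minor G Y X) (minor G X (Z G))

      -- Both sides of coassociativity are sums of chain Y X over pairs of closed sets Y ⊆ X.
      left : ∀ X → Δcoeff (λ G₁ G₂ → g G₁ G₂ (minor G X (Z G))) (minor G ⊥ X) ≈
                   ∑[ Y ∈ allSubsets (n G) ] when (E G Y) (when ⌊ Y ⊆? X ⌋ (chain Y X))
      left X = ∑-cong (allSubsets (n G)) λ Y →
        trans (reflexive (when-split (E G Y) ⌊ Y ⊆? X ⌋ _ (E-minor-⊥ G X Y)))
              (when-cong (E G Y) λ _ → when-cong ⌊ Y ⊆? X ⌋ λ Y⊆X → let Y⊆X = ⌊⌋-true⁻ (Y ⊆? X) Y⊆X in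
                g-inv _ _ _ _ _ _ (below Y⊆X) (between Y⊆X) (Iso-refl (minor G X (Z G))))
        where
        below : ∀ {Y} → Y ⊆ X → Iso (minor (minor G ⊥ X) ⊥ Y) (minor G ⊥ Y)
        below {Y} Y⊆X = ≡.subst₂ (λ U V → Iso (minor (minor G ⊥ X) U V) (minor G ⊥ Y)) (p─⊥≡p ⊥) (p─⊥≡p Y)
                                 (minor-minor-Iso G (⊆-min ⊥) (⊆-min Y) Y⊆X)
        between : ∀ {Y} → Y ⊆ X → Iso (minor (minor G ⊥ X) Y (X ─ ⊥)) (minor G Y X)
        between {Y} Y⊆X = ≡.subst (λ U → Iso (minor (minor G ⊥ X) U (X ─ ⊥)) (minor G Y X)) (p─⊥≡p Y)
                                  (minor-minor-Iso G (⊆-min Y) Y⊆X λ x → x)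

      right : ∀ Y → Δcoeff (λ H₁ H₂ → g (minor G ⊥ Y) H₁ H₂) (minor G Y (Z G)) ≈
                    ∑[ X ∈ allSubsets (n G) ] when (E G X) (when ⌊ Y ⊆? X ⌋ (chain Y X))
      right Y = begin
        Δcoeff (λ H₁ H₂ → g (minor G ⊥ Y) H₁ H₂) (minor G Y (Z G))
          ≈⟨ ∑-reindex (λ X → E G X ∧ ⌊ Y ⊆? X ⌋) (E (minor G Y (Z G))) (_─ Y) (_∪ Y) h
                       P⇒Qφ Q⇒Pψ ψφ φψ ⟨
        ∑[ X ∈ allSubsets (n G) ] when (E G X ∧ ⌊ Y ⊆? X ⌋) (h (X ─ Y))
          ≈⟨ ∑-cong (allSubsets (n G)) (λ X → trans (reflexive (when-∧ (E G X) _ _))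
               (when-cong (E G X) λ cX → when-cong ⌊ Y ⊆? X ⌋ λ Y⊆X → let Y⊆X = ⌊⌋-true⁻ (Y ⊆? X) Y⊆X in
                 g-inv _ _ _ _ _ _ (Iso-refl (minor G ⊥ Y)) (below cX Y⊆X) (above Y⊆X (closed⊆Z X cX)))) ⟩
        ∑[ X ∈ allSubsets (n G) ] when (E G X) (when ⌊ Y ⊆? X ⌋ (chain Y X)) ∎
        where
        h : Subset (n G) → Carrier
        h V = g (minor G ⊥ Y) (minor (minor G Y (Z G)) ⊥ V) (minor (minor G Y (Z G)) V (Z G ─ Y))
        P⇒Qφ : ∀ X → E G X ∧ ⌊ Y ⊆? X ⌋ ≡ true → Closed (minor G Y (Z G)) (X ─ Y)
        P⇒Qφ X e = let cX , Y⊆X = ∧-elim e in minor-closed⁺ G cX (⌊⌋-true⁻ (Y ⊆? X) Y⊆X) (closed⊆Z X cX) ≡.refl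
        Q⇒Pψ : ∀ V → Closed (minor G Y (Z G)) V → E G (V ∪ Y) ∧ ⌊ Y ⊆? (V ∪ Y) ⌋ ≡ true
        Q⇒Pψ V cV with minor-closed⁻ G Y (Z G) cV
        ... | preimage U cU Y⊆U _ ≡.refl rewrite q⊆p⇒p─q∪q≡p U Y Y⊆U = ∧-intro cU (⌊⌋-true⁺ (Y ⊆? U) Y⊆U)
        ψφ : ∀ X → E G X ∧ ⌊ Y ⊆? X ⌋ ≡ true → (X ─ Y) ∪ Y ≡ X
        ψφ X e = q⊆p⇒p─q∪q≡p X Y (⌊⌋-true⁻ (Y ⊆? X) (proj₂ (∧-elim e)))
        φψ : ∀ V → Closed (minor G Y (Z G)) V → (V ∪ Y) ─ Y ≡ V
        φψ V cV with minor-closed⁻ G Y (Z G) cV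
        ... | preimage U _ Y⊆U _ ≡.refl = ≡.cong (_─ Y) (q⊆p⇒p─q∪q≡p U Y Y⊆U)
        below : ∀ {X} → Closed G X → Y ⊆ X → Iso (minor (minor G Y (Z G)) ⊥ (X ─ Y)) (minor G Y X)
        below {X} cX Y⊆X = ≡.subst (λ U → Iso (minor (minor G Y (Z G)) U (X ─ Y)) (minor G Y X)) (p─p≡⊥ Y)
                                   (minor-minor-Iso G (λ x → x) Y⊆X (closed⊆Z X cX))
        above : ∀ {X} → Y ⊆ X → X ⊆ Z G → Iso (minor (minor G Y (Z G)) (X ─ Y) (Z G ─ Y)) (minor G X (Z G))
        above Y⊆X X⊆Z = minor-minor-Iso G Y⊆X X⊆Z (λ x → x)

    Δcoeff-coassoc : Δcoeff (λ G′ H → Δcoeff (λ G₁ G₂ → g G₁ G₂ H) G′) G ≈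
                     Δcoeff (λ G′ H → Δcoeff (λ H₁ H₂ → g G′ H₁ H₂) H) G
    Δcoeff-coassoc = begin
      Δcoeff (λ G′ H → Δcoeff (λ G₁ G₂ → g G₁ G₂ H) G′) G
        ≈⟨ ∑-cong all (λ X → when-cong (E G X) (λ _ → left X)) ⟩
      ∑[ X ∈ all ] when (E G X) (∑[ Y ∈ all ] when (E G Y) (when ⌊ Y ⊆? X ⌋ (chain Y X)))
        ≈⟨ ∑-cong all (λ X → when-∑ (E G X) all _) ⟩
      ∑[ X ∈ all ] ∑[ Y ∈ all ] when (E G X) (when (E G Y) (when ⌊ Y ⊆? X ⌋ (chain Y X)))
        ≈⟨ ∑-cong all (λ X → ∑-cong all (λ Y → reflexive (when-comm (E G X) (E G Y) _))) ⟩
      ∑[ X ∈ all ] ∑[ Y ∈ all ] when (E G Y) (when (E G X) (when ⌊ Y ⊆? X ⌋ (chain Y X)))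
        ≈⟨ ∑-comm all all _ ⟩
      ∑[ Y ∈ all ] ∑[ X ∈ all ] when (E G Y) (when (E G X) (when ⌊ Y ⊆? X ⌋ (chain Y X)))
        ≈⟨ ∑-cong all (λ Y → when-∑ (E G Y) all _) ⟨
      ∑[ Y ∈ all ] when (E G Y) (∑[ X ∈ all ] when (E G X) (when ⌊ Y ⊆? X ⌋ (chain Y X)))
        ≈⟨ ∑-cong all (λ Y → when-cong (E G Y) (λ _ → right Y)) ⟨
      Δcoeff (λ G′ H → Δcoeff (λ H₁ H₂ → g G′ H₁ H₂) H) G ∎
      where all = allSubsets (n G)

  Δ-coassoc : ∀ {a} → AllCG a → Δ⊗id (Δ a) ≈₃ id⊗Δ (Δ a)
  Δ-coassoc {a} cg-a g g-inv = begin
    ev₃ g (Δ⊗id (Δ a))                                             ≈⟨ ev-Δ⊗id g (Δ a) ⟩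
    ev₂ (λ G H → Δcoeff (λ G₁ G₂ → g G₁ G₂ H) G) (Δ a)             ≈⟨ ev-Δ _ a ⟩
    ev₁ (Δcoeff (λ G H → Δcoeff (λ G₁ G₂ → g G₁ G₂ H) G)) a
      ≈⟨ eval-congᴬ cg-a (λ G cg → Δcoeff-coassoc g-inv cg) ⟩
    ev₁ (Δcoeff (λ G H → Δcoeff (λ H₁ H₂ → g G H₁ H₂) H)) a        ≈⟨ ev-Δ _ a ⟨
    ev₂ (λ G H → Δcoeff (λ H₁ H₂ → g G H₁ H₂) H) (Δ a)             ≈⟨ ev-id⊗Δ g (Δ a) ⟨
    ev₃ g (id⊗Δ (Δ a))                                             ∎

mainTheorem8 : ∀ {c ℓ : Level} (K : Field c ℓ) →
    let open Field K
        open Spaces K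
    in
    -- m is well defined: the product of convex geometries is a convex geometry
    (∀ G H → IsConvexGeometry G → IsConvexGeometry H →
       IsConvexGeometry (product G H))
    -- (the minors occurring in Δ are convex geometries)
    × (∀ G A B → IsConvexGeometry G → Closed G A → Closed G B → A ⊆ B →
       IsConvexGeometry (minor G A B))
    -- m is well defined on isomorphism classes
    × (∀ a a' b b' → AllCG a → AllCG a' → AllCG b → AllCG b' →
       a ≈₁ a' → b ≈₁ b' → (a · b) ≈₁ (a' · b'))
    -- Δ and ε are well defined on isomorphism classes
    × (∀ a a' → AllCG a → AllCG a' → a ≈₁ a' → Δ a ≈₂ Δ a')
    × (∀ a a' → AllCG a → AllCG a' → a ≈₁ a' → ε a ≈ ε a')
    -- algebra axioms
    × (∀ a b d → AllCG a → AllCG b → AllCG d → ((a · b) · d) ≈₁ (a · (b · d)))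
    × (∀ a → AllCG a → (one · a) ≈₁ a)
    × (∀ a → AllCG a → (a · one) ≈₁ a)
    -- coalgebra axioms
    × (∀ a → AllCG a → Δ⊗id (Δ a) ≈₃ id⊗Δ (Δ a))
    × (∀ a → AllCG a → ε⊗id (Δ a) ≈₁ a)
    × (∀ a → AllCG a → id⊗ε (Δ a) ≈₁ a)
    -- Δ and ε are algebra morphisms
    × (∀ a b → AllCG a → AllCG b → Δ (a · b) ≈₂ (Δ a ·² Δ b))
    × (Δ one ≈₂ one²)
    × (∀ a b → AllCG a → AllCG b → ε (a · b) ≈ (ε a * ε b))
    × (ε one ≈ 1#)
mainTheorem8 K =
  (λ _ _ → product-isConvexGeometry) ,
  (λ _ _ _ → minor-isConvexGeometry) ,
  (λ a a′ b b′ _ _ _ _ → ·-cong K {a} {a′} {b} {b′}) ,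
  (λ a a′ → Δ-cong K {a} {a′}) ,
  (λ a a′ → ε-cong K {a} {a′}) ,
  (λ a b d _ _ _ → ·-assoc K a b d) ,
  (λ a _ → ·-identityˡ K a) ,
  (λ a _ → ·-identityʳ K a) ,
  (λ a → Δ-coassoc K {a}) ,
  (λ a → ε-counitˡ K {a}) ,
  (λ a → ε-counitʳ K {a}) ,
  (λ a b _ _ → Δ-homo K a b) ,
  Δ-one K ,
  (λ a b _ _ → ε-homo K a b) ,
  ε-one K
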